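{- Let $n\ge1$ and let $P$ be an $n\times n$ Petrie matrix, with its $r$-th row written as $v[a_r,b_r]$ ($0\le a_r\le b_r\le n$). For a good orientation $\sigma$ put $w(\sigma)=(-1)^{|\sigma|+\operatorname{inv}(\sigma)}$. (1) If $P$ has exactly one good orientation $\sigma$, then $\det(P)=w(\sigma)$. (2) If $P$ has more than one good orientation, then for every good orientation $\sigma$ and every cycle $C$ of the Petrie graph whose edges form a directed cycle under $\sigma$, letting $\varphi_C(\sigma)$ denote the orientation obtained from $\sigma$ by reversing the choice for every row corresponding to an edge of $C$ (again a good orientation), one has $w(\varphi_C(\sigma))=-w(\sigma)$. Hence, in either case, \[\det(P)=\sum_{\sigma\ \text{good}} w(\sigma).\]
   Context: For integers $0\le a\le b\le n$, $v[a,b]$ denotes the row vector of length $n$ whose entries in positions $a+1,\dots,b$ are $1$ and whose other entries are $0$. An $n\times n$ Petrie matrix is a $0/1$ matrix each of whose rows is of the form $v[a,b]$; for each row $r$ a representation $v[a_r,b_r]$ is fixed (for a zero row any $a_r=b_r$). The Petrie graph of $P$ is the multigraph on $\{0,1,\dots,n\}$ with one edge $\{a_r,b_r\}$ for each row $r$ (self-loops allowed). A cycle of this multigraph means a self-loop, a pair of parallel edges, or a simple cycle of length at least $3$. An orientation $\sigma$ chooses for each row $r$ either the unreversed pair $(c_r,d_r)=(a_r,b_r)$ or the reversed pair $(c_r,d_r)=(b_r,a_r)$ (two distinct choices even if $a_r=b_r$); the edge of row $r$ is then directed from $c_r$ to $d_r$. The orientation is good if $(c_1,\dots,c_n)$ is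 a permutation of $\{0,\dots,n-1\}$, i.e. every vertex other than $n$ has exactly one outgoing edge and $n$ has none. $|\sigma|$ is the number of reversed rows and $\operatorname{inv}(\sigma)=\#\{(r,s): r<s,\ c_r>c_s\}$. -}

module Defs where

open import Data.Nat as ℕ using (ℕ; zero; suc; _≤_; _<_)
import Data.Nat.Properties as ℕP
open import Data.Integer as ℤ using (ℤ; 0ℤ; 1ℤ; -1ℤ)
open import Data.Fin as Fin using (Fin; toℕ; punchIn)
import Data.Fin.Properties as FinP
open import Data.Bool using (Bool; true; false; if_then_else_; _∧_; not)
open import Data.List using (List; []; _∷_; map; allFin; foldr; filter; concatMap; _++_)
open import Data.Product using (Σ; _×_; _,_; ∃)
import Data.Vec.Functional as VF
open import Data.Nat.DivMod using (_%_; m%n<n)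
open import Relation.Nullary using (Dec; ¬_)
open import Relation.Nullary.Decidable using (⌊_⌋; _×-dec_; _→-dec_)
open import Relation.Binary.PropositionalEquality using (_≡_)

sumℕ : List ℕ → ℕ
sumℕ = foldr ℕ._+_ 0

sumℤ : List ℤ → ℤ
sumℤ = foldr ℤ._+_ 0ℤ

Matrix : ℕ → Set
Matrix n = Fin n → Fin n → ℤ

det : (n : ℕ) → Matrix n → ℤ
det zero    M = 1ℤ
det (suc n) M =
  sumℤ (map (λ j → ((-1ℤ ℤ.^ toℕ j) ℤ.* M Fin.zero j)
                     ℤ.* det n (λ r c → M (Fin.suc r) (punchIn j c)))
            (allFin (suc n)))

-- Petrie matrices.  Row r is v[a r, b r]: entry (r, j) (0-based column j,
-- i.e. position j+1) is 1 iff a r ≤ j < b r.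

record PetrieData (n : ℕ) : Set where
  field
    a   : Fin n → ℕ
    b   : Fin n → ℕ
    a≤b : ∀ r → a r ≤ b r
    b≤n : ∀ r → b r ≤ n

open PetrieData public

petrieMatrix : ∀ {n} → PetrieData n → Matrix n
petrieMatrix P r j =
  if ⌊ a P r ℕ.≤? toℕ j ⌋ ∧ ⌊ toℕ j ℕ.<? b P r ⌋ then 1ℤ else 0ℤ

-- Orientations: σ r = true means row r is reversed.

Orientation : ℕ → Set
Orientation n = Fin n → Bool

src : ∀ {n} → PetrieData n → Orientation n → Fin n → ℕ
src P σ r = if σ r then b P r else a P r

tgt : ∀ {n} → PetrieData n → Orientation n → Fin n → ℕ
tgt P σ r = if σ r then a P r else b P r

Good : ∀ {n} → PetrieData n → Orientation n → Set
Good {n} P σ = (∀ r → src P σ r < n)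
             × (∀ r s → src P σ r ≡ src P σ s → r ≡ s)

good? : ∀ {n} (P : PetrieData n) (σ : Orientation n) → Dec (Good P σ)
good? {n} P σ =
  FinP.all? (λ r → src P σ r ℕ.<? n)
  ×-dec FinP.all? (λ r → FinP.all? (λ s →
          (src P σ r ℕ.≟ src P σ s) →-dec (r FinP.≟ s)))

size : ∀ {n} → Orientation n → ℕ
size {n} σ = sumℕ (map (λ r → if σ r then 1 else 0) (allFin n))

inv : ∀ {n} → PetrieData n → Orientation n → ℕ
inv {n} P σ =
  sumℕ (map (λ r → sumℕ (map (λ s →
      if ⌊ r FinP.<? s ⌋ ∧ ⌊ src P σ s ℕ.<? src P σ r ⌋ then 1 else 0)
    (allFin n))) (allFin n))

w : ∀ {n} → PetrieData n → Orientation n → ℤ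
w P σ = -1ℤ ℤ.^ (size σ ℕ.+ inv P σ)

allOrientations : (n : ℕ) → List (Orientation n)
allOrientations zero    = (λ ()) ∷ []
allOrientations (suc n) =
  concatMap (λ β → map (λ σ → β VF.∷ σ) (allOrientations n)) (false ∷ true ∷ [])

sumGood : ∀ {n} → PetrieData n → ℤ
sumGood {n} P = sumℤ (map (w P) (filter (good? P) (allOrientations n)))

-- A cycle of length k ≥ 1 is given by distinct rows e 0,…,e (k-1) and
-- distinct vertices v 0,…,v (k-1) such that row e i is the edge
-- {v i, v (i+1 mod k)}; k = 1 is a self-loop, k = 2 a pair of parallel
-- edges, k ≥ 3 a simple cycle.

next : ∀ {k} → Fin k → Fin k
next {suc k} i = Fin.fromℕ< (m%n<n (suc (toℕ i)) (suc k))

flipRows : ∀ {n k} → Orientation n → (Fin k → Fin n) → Orientation n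
flipRows {k = k} σ e r =
  if ⌊ FinP.any? (λ i → e i FinP.≟ r) ⌋ then not (σ r) else σ r

record DirectedCycle {n} (P : PetrieData n) (σ : Orientation n) : Set where
  field
    len      : ℕ
    len≥1    : 1 ≤ len
    edge     : Fin len → Fin n
    vertex   : Fin len → ℕ
    edge-inj   : ∀ i j → edge i ≡ edge j → i ≡ j
    vertex-inj : ∀ i j → vertex i ≡ vertex j → i ≡ j
    edge-src : ∀ i → src P σ (edge i) ≡ vertex i
    edge-tgt : ∀ i → tgt P σ (edge i) ≡ vertex (next i)

open DirectedCycle public

φ : ∀ {n} {P : PetrieData n} {σ : Orientation n} → DirectedCycle P σ → Orientation n
φ {σ = σ} C = flipRows σ (edge C)

-- Each row v[a, b] of P is the difference v[a, n] - v[b, n] of two step rows, so by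
-- multilinearity det P is the sum over all 2^n orientations σ of (-1)^|σ| times the
-- determinant of the step matrix with rows v[c_r, n].  That determinant is (-1)^inv if
-- (c_r) is a permutation of {0, …, n-1} and 0 otherwise: splitting the first row
-- v[k, n] = e_k + v[k+1, n] gives a recursion that the right-hand side satisfies too.
-- Hence det P is the sum of w over the good orientations, which is w σ when σ is the
-- only one.  Reversing the rows of a directed cycle of length k composes (c_r) with a
-- k-cycle of values, a product of k - 1 transpositions each of which changes the parity
-- of inv, while |σ| changes by k modulo 2; hence w changes sign.

module Submission where

open import Defs
open import Data.Nat as ℕ using (ℕ; zero; suc; _≤_; _<_; z≤n; s≤s)
import Data.Nat.Properties as ℕP
open import Data.Integer as ℤ using (ℤ; 0ℤ; 1ℤ; -1ℤ; -_; _+_; _*_; _-_)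
import Data.Integer.Properties as ℤP
open import Data.Integer.Tactic.RingSolver using (solve-∀)
open import Data.Fin as Fin using (Fin; toℕ; punchIn; zero; suc)
import Data.Fin.Properties as FinP
open import Data.Bool using (Bool; true; false; if_then_else_; _∧_; not)
import Data.Bool.Properties as BoolP
open import Data.List using (List; []; _∷_; map; allFin; filter; _++_; foldr; tabulate)
import Data.List.Properties as ListP
import Data.Vec.Functional as Vector
open import Data.Product using (Σ; _×_; _,_; ∃; proj₁; proj₂)
open import Data.Sum using (_⊎_; inj₁; inj₂)
open import Data.Empty using (⊥; ⊥-elim)
open import Function using (_∘_; id)
open import Data.Nat.DivMod using (_%_; m%n<n; n%n≡0; m<n⇒m%n≡m)
open import Relation.Nullary using (Dec; yes; no; ¬_)
open import Relation.Nullary.Decidable as Dec using (⌊_⌋)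
open import Relation.Binary.PropositionalEquality
open import Relation.Binary using (Tri; tri<; tri≈; tri>)
import Algebra.Properties.Semiring.Sum as SemiringSum

module ℤ∑ = SemiringSum ℤP.+-*-semiring
module ℕ∑ = SemiringSum ℕP.+-*-semiring
open ℤ∑ using () renaming (sum to ∑ℤ)
open ℕ∑ using () renaming (sum to ∑ℕ)

module _ {a} {A : Set a} where

  ⌊⌋-true : (a? : Dec A) → A → ⌊ a? ⌋ ≡ true
  ⌊⌋-true a? x = trans (Dec.isYes≗does a?) (Dec.dec-true a? x)

  ⌊⌋-false : (a? : Dec A) → ¬ A → ⌊ a? ⌋ ≡ false
  ⌊⌋-false a? ¬x = trans (Dec.isYes≗does a?) (Dec.dec-false a? ¬x)

  ⌊⌋-⇔ : ∀ {b} {B : Set b} → (A → B) → (B → A) → (a? : Dec A) (b? : Dec B) → ⌊ a? ⌋ ≡ ⌊ b? ⌋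
  ⌊⌋-⇔ f g a? (yes y) = ⌊⌋-true a? (g y)
  ⌊⌋-⇔ f g a? (no ¬y) = ⌊⌋-false a? (¬y ∘ f)

𝟙 : Bool → ℕ
𝟙 β = if β then 1 else 0

𝟙ℤ : Bool → ℤ
𝟙ℤ β = if β then 1ℤ else 0ℤ

sgn : ℕ → ℤ
sgn k = -1ℤ ℤ.^ k

sgn-+ : ∀ m n → sgn (m ℕ.+ n) ≡ sgn m * sgn n
sgn-+ = ℤP.^-distribˡ-+-* -1ℤ

sgn-suc : ∀ n → sgn (suc n) ≡ - sgn n
sgn-suc n = ℤP.-1*i≡-i (sgn n)

sgn-sq : ∀ n → sgn n * sgn n ≡ 1ℤ
sgn-sq zero = refl
sgn-sq (suc n) = begin
  sgn (suc n) * sgn (suc n) ≡⟨ cong₂ _*_ (sgn-suc n) (sgn-suc n) ⟩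
  (- sgn n) * (- sgn n)     ≡⟨ neg*neg (sgn n) ⟩
  sgn n * sgn n             ≡⟨ sgn-sq n ⟩
  1ℤ                        ∎
  where
  open ≡-Reasoning
  neg*neg : ∀ x → (- x) * (- x) ≡ x * x
  neg*neg = solve-∀

sgn-+-even : ∀ a d → sgn (a ℕ.+ (d ℕ.+ d)) ≡ sgn a
sgn-+-even a d = begin
  sgn (a ℕ.+ (d ℕ.+ d))  ≡⟨ sgn-+ a (d ℕ.+ d) ⟩
  sgn a * sgn (d ℕ.+ d)  ≡⟨ cong (sgn a *_) (trans (sgn-+ d d) (sgn-sq d)) ⟩
  sgn a * 1ℤ             ≡⟨ ℤP.*-identityʳ (sgn a) ⟩
  sgn a                  ∎
  where open ≡-Reasoning

foldr-tabulate : ∀ {A B : Set} (f : A → B → B) (z : B) {n} (g : Fin n → A) →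
                 foldr f z (tabulate g) ≡ Vector.foldr f z g
foldr-tabulate f z {zero} g = refl
foldr-tabulate f z {suc n} g = cong (f (g zero)) (foldr-tabulate f z (g ∘ suc))

∑ℤ-allFin : ∀ n (f : Fin n → ℤ) → sumℤ (map f (allFin n)) ≡ ∑ℤ f
∑ℤ-allFin n f = trans (cong sumℤ (ListP.map-tabulate id f)) (foldr-tabulate _+_ 0ℤ f)

∑ℕ-allFin : ∀ n (f : Fin n → ℕ) → sumℕ (map f (allFin n)) ≡ ∑ℕ f
∑ℕ-allFin n f = trans (cong sumℕ (ListP.map-tabulate id f)) (foldr-tabulate ℕ._+_ 0 f)

∑ℕ-ones : ∀ m → ∑ℕ (λ (_ : Fin m) → 1) ≡ m
∑ℕ-ones zero    = refl
∑ℕ-ones (suc m) = cong suc (∑ℕ-ones m)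

∑∑ : ∀ {n} → (Fin n → Fin n → ℕ) → ℕ
∑∑ f = ∑ℕ (λ r → ∑ℕ (f r))

at : ∀ {n} → Fin n → Fin n → ℕ → Fin n → Fin n → ℕ
at p q K r s = if ⌊ p FinP.≟ r ⌋ ∧ ⌊ q FinP.≟ s ⌋ then K else 0

∑-at : ∀ {n} (p : Fin n) K → ∑ℕ (λ r → if ⌊ p FinP.≟ r ⌋ then K else 0) ≡ K
∑-at {suc n} zero K = trans (cong (K ℕ.+_) (ℕ∑.sum-replicate-zero n)) (ℕP.+-identityʳ K)
∑-at {suc n} (suc p) K = trans (ℕ∑.sum-cong-≗ λ r → cong (λ β → if β then K else 0)
                                  (⌊⌋-⇔ FinP.suc-injective (cong suc) (suc p FinP.≟ suc r) (p FinP.≟ r)))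
                               (∑-at p K)

∑∑-at : ∀ {n} (p q : Fin n) K → ∑∑ (at p q K) ≡ K
∑∑-at {n} p q K = trans (ℕ∑.sum-cong-≗ (λ r → row ⌊ p FinP.≟ r ⌋)) (∑-at p K)
  where
  row : ∀ β → ∑ℕ (λ s → if β ∧ ⌊ q FinP.≟ s ⌋ then K else 0) ≡ (if β then K else 0)
  row true  = ∑-at q K
  row false = ℕ∑.sum-replicate-zero n

∑∑-distrib-+ : ∀ {n} (f g : Fin n → Fin n → ℕ) → ∑∑ (λ r s → f r s ℕ.+ g r s) ≡ ∑∑ f ℕ.+ ∑∑ g
∑∑-distrib-+ f g = trans (ℕ∑.sum-cong-≗ (λ r → ℕ∑.∑-distrib-+ (f r) (g r)))
                         (ℕ∑.∑-distrib-+ (λ r → ∑ℕ (f r)) (λ r → ∑ℕ (g r)))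

at-here : ∀ {n} (p q : Fin n) K → at p q K p q ≡ K
at-here p q K rewrite ⌊⌋-true (p FinP.≟ p) refl | ⌊⌋-true (q FinP.≟ q) refl = refl

at-elsewhere : ∀ {n} (p q r s : Fin n) K → ¬ (r ≡ p × s ≡ q) → at p q K r s ≡ 0
at-elsewhere p q r s K off with p FinP.≟ r | q FinP.≟ s
... | yes refl | yes refl = ⊥-elim (off (refl , refl))
... | yes _    | no  _    = refl
... | no  _    | _        = refl

∑∑-exchange : ∀ {n} (f g : Fin n → Fin n → ℕ) (p q : Fin n) → p ≢ q →
              (∀ r s → ¬ (r ≡ p × s ≡ q) → ¬ (r ≡ q × s ≡ p) → f r s ≡ g r s) →
              ∑∑ f ℕ.+ (g p q ℕ.+ g q p) ≡ ∑∑ g ℕ.+ (f p q ℕ.+ f q p)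
∑∑-exchange {n} f g p q p≢q agree = begin
  ∑∑ f ℕ.+ (g p q ℕ.+ g q p)                         ≡⟨ spread-sum f (g p q) (g q p) ⟨
  ∑∑ (λ r s → f r s ℕ.+ spread (g p q) (g q p) r s)  ≡⟨ ℕ∑.sum-cong-≗ (λ r → ℕ∑.sum-cong-≗ (pointwise r)) ⟩
  ∑∑ (λ r s → g r s ℕ.+ spread (f p q) (f q p) r s)  ≡⟨ spread-sum g (f p q) (f q p) ⟩
  ∑∑ g ℕ.+ (f p q ℕ.+ f q p)                         ∎
  where
  open ≡-Reasoning
  spread : ℕ → ℕ → Fin n → Fin n → ℕ
  spread K L r s = at p q K r s ℕ.+ at q p L r s
  spread-sum : ∀ h K L → ∑∑ (λ r s → h r s ℕ.+ spread K L r s) ≡ ∑∑ h ℕ.+ (K ℕ.+ L)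
  spread-sum h K L = trans (∑∑-distrib-+ h (spread K L))
    (cong (∑∑ h ℕ.+_) (trans (∑∑-distrib-+ (at p q K) (at q p L)) (cong₂ ℕ._+_ (∑∑-at p q K) (∑∑-at q p L))))
  pointwise : ∀ r s → f r s ℕ.+ spread (g p q) (g q p) r s ≡ g r s ℕ.+ spread (f p q) (f q p) r s
  pointwise r s with (r FinP.≟ p) Dec.×-dec (s FinP.≟ q) | (r FinP.≟ q) Dec.×-dec (s FinP.≟ p)
  ... | yes (refl , refl) | _ rewrite at-here r s (g r s) | at-here r s (f r s)
                                    | at-elsewhere s r r s (g s r) (λ (r≡s , _) → p≢q r≡s)
                                    | at-elsewhere s r r s (f s r) (λ (r≡s , _) → p≢q r≡s) =
    trans (cong (f r s ℕ.+_) (ℕP.+-identityʳ _)) (trans (ℕP.+-comm (f r s) (g r s)) (cong (g r s ℕ.+_) (sym (ℕP.+-identityʳ _))))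
  ... | no _ | yes (refl , refl) rewrite at-here r s (g r s) | at-here r s (f r s)
                                       | at-elsewhere s r r s (g s r) (λ (r≡s , _) → p≢q (sym r≡s))
                                       | at-elsewhere s r r s (f s r) (λ (r≡s , _) → p≢q (sym r≡s)) =
    ℕP.+-comm (f r s) (g r s)
  ... | no ¬pq | no ¬qp rewrite at-elsewhere p q r s (g p q) ¬pq | at-elsewhere q p r s (g q p) ¬qp
                              | at-elsewhere p q r s (f p q) ¬pq | at-elsewhere q p r s (f q p) ¬qp =
    cong (ℕ._+ 0) (agree r s ¬pq ¬qp)

module _ {A : Set} where

  listSum : List A → (A → ℤ) → ℤ
  listSum xs f = sumℤ (map f xs)

  listSum-cong : ∀ xs {f g : A → ℤ} → (∀ x → f x ≡ g x) → listSum xs f ≡ listSum xs g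
  listSum-cong [] e = refl
  listSum-cong (x ∷ xs) e = cong₂ _+_ (e x) (listSum-cong xs e)

  listSum-zero : ∀ xs (f : A → ℤ) → (∀ x → f x ≡ 0ℤ) → listSum xs f ≡ 0ℤ
  listSum-zero [] f e = refl
  listSum-zero (x ∷ xs) f e = cong₂ _+_ (e x) (listSum-zero xs f e)

  listSum-++ : ∀ xs ys (f : A → ℤ) → listSum (xs ++ ys) f ≡ listSum xs f + listSum ys f
  listSum-++ [] ys f = sym (ℤP.+-identityˡ _)
  listSum-++ (x ∷ xs) ys f = trans (cong (f x +_) (listSum-++ xs ys f)) (sym (ℤP.+-assoc (f x) _ _))

  listSum-distrib-+ : ∀ xs (f g : A → ℤ) → listSum xs (λ x → f x + g x) ≡ listSum xs f + listSum xs g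
  listSum-distrib-+ [] f g = refl
  listSum-distrib-+ (x ∷ xs) f g =
    trans (cong (f x + g x +_) (listSum-distrib-+ xs f g)) (interchange (f x) (g x) _ _)
    where
    interchange : ∀ a b c d → (a + b) + (c + d) ≡ (a + c) + (b + d)
    interchange = solve-∀

  listSum-*ˡ : ∀ xs (k : ℤ) (f : A → ℤ) → listSum xs (λ x → k * f x) ≡ k * listSum xs f
  listSum-*ˡ [] k f = sym (ℤP.*-zeroʳ k)
  listSum-*ˡ (x ∷ xs) k f =
    trans (cong (k * f x +_) (listSum-*ˡ xs k f)) (sym (ℤP.*-distribˡ-+ k (f x) _))

  listSum-comm-∑ℤ : ∀ xs {m} (f : A → Fin m → ℤ) →
                    listSum xs (λ x → ∑ℤ (f x)) ≡ ∑ℤ (λ j → listSum xs (λ x → f x j))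
  listSum-comm-∑ℤ [] {m} f = sym (ℤ∑.sum-replicate-zero m)
  listSum-comm-∑ℤ (x ∷ xs) f =
    trans (cong (∑ℤ (f x) +_) (listSum-comm-∑ℤ xs f)) (sym (ℤ∑.∑-distrib-+ (f x) _))

  listSum-filter : ∀ {p} {P : A → Set p} (P? : ∀ x → Dec (P x)) xs (f : A → ℤ) →
                   sumℤ (map f (filter P? xs)) ≡ listSum xs (λ x → if ⌊ P? x ⌋ then f x else 0ℤ)
  listSum-filter P? [] f = refl
  listSum-filter P? (x ∷ xs) f with P? x
  ... | yes _ = cong (f x +_) (listSum-filter P? xs f)
  ... | no  _ = trans (listSum-filter P? xs f) (sym (ℤP.+-identityˡ _))

listSum-map : ∀ {A B : Set} (g : B → A) xs (f : A → ℤ) → listSum (map g xs) f ≡ listSum xs (f ∘ g)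
listSum-map g [] f = refl
listSum-map g (x ∷ xs) f = cong (f (g x) +_) (listSum-map g xs f)

∑ₒ : ∀ n → (Orientation n → ℤ) → ℤ
∑ₒ n = listSum (allOrientations n)

∑ₒ-suc : ∀ n (F : Orientation (suc n) → ℤ) →
         ∑ₒ (suc n) F ≡ ∑ₒ n (F ∘ (false Vector.∷_)) + ∑ₒ n (F ∘ (true Vector.∷_))
∑ₒ-suc n F = begin
  listSum (L false ++ (L true ++ [])) F
    ≡⟨ listSum-++ (L false) _ F ⟩
  listSum (L false) F + listSum (L true ++ []) F
    ≡⟨ cong (λ l → listSum (L false) F + listSum l F) (ListP.++-identityʳ (L true)) ⟩
  listSum (L false) F + listSum (L true) F
    ≡⟨ cong₂ _+_ (listSum-map _ (allOrientations n) F) (listSum-map _ (allOrientations n) F) ⟩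
  ∑ₒ n (F ∘ (false Vector.∷_)) + ∑ₒ n (F ∘ (true Vector.∷_)) ∎
  where
  open ≡-Reasoning
  L : Bool → List (Orientation (suc n))
  L β = map (β Vector.∷_) (allOrientations n)

∑ₒ-supported : ∀ n (σ : Orientation n) (F : Orientation n → ℤ) →
               (∀ τ → ¬ τ ≗ σ → F τ ≡ 0ℤ) → (∀ τ → τ ≗ σ → F τ ≡ F σ) → ∑ₒ n F ≡ F σ
∑ₒ-supported zero σ F off on = trans (ℤP.+-identityʳ _) (on _ (λ ()))
∑ₒ-supported (suc n) σ F off on = trans (∑ₒ-suc n F) (halves (σ zero) refl)
  where
  on-branch : ∀ β → σ zero ≡ β → ∑ₒ n (F ∘ (β Vector.∷_)) ≡ F σ
  on-branch β e = trans (∑ₒ-supported n (σ ∘ suc) (F ∘ (β Vector.∷_))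
                           (λ τ τ≉ → off _ (λ h → τ≉ (h ∘ suc)))
                           (λ τ τ≈ → trans (on _ (agree τ τ≈)) (sym (on _ (agree _ (λ _ → refl))))))
                        (on _ (agree _ (λ _ → refl)))
    where
    agree : ∀ τ → τ ≗ σ ∘ suc → (β Vector.∷ τ) ≗ σ
    agree τ h zero = sym e
    agree τ h (suc r) = h r
  off-branch : ∀ β → σ zero ≡ β → ∑ₒ n (F ∘ (not β Vector.∷_)) ≡ 0ℤ
  off-branch β e = listSum-zero (allOrientations n) _
                     (λ τ → off (not β Vector.∷ τ) (λ h → BoolP.not-¬ refl (sym (trans (h zero) e))))
  halves : ∀ β → σ zero ≡ β → ∑ₒ n (F ∘ (false Vector.∷_)) + ∑ₒ n (F ∘ (true Vector.∷_)) ≡ F σ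
  halves false e = trans (cong₂ _+_ (on-branch false e) (off-branch false e)) (ℤP.+-identityʳ _)
  halves true  e = trans (cong₂ _+_ (off-branch true e) (on-branch true e)) (ℤP.+-identityˡ _)

size-∑ : ∀ {n} (σ : Orientation n) → size σ ≡ ∑ℕ (𝟙 ∘ σ)
size-∑ {n} σ = ∑ℕ-allFin n (𝟙 ∘ σ)

sgn-size-cons : ∀ {n} β (τ : Orientation n) →
                sgn (size (β Vector.∷ τ)) ≡ (if β then - sgn (size τ) else sgn (size τ))
sgn-size-cons β τ = begin
  sgn (size (β Vector.∷ τ))   ≡⟨ cong sgn (size-∑ (β Vector.∷ τ)) ⟩
  sgn (𝟙 β ℕ.+ ∑ℕ (𝟙 ∘ τ))    ≡⟨ cong (λ k → sgn (𝟙 β ℕ.+ k)) (size-∑ τ) ⟨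
  sgn (𝟙 β ℕ.+ size τ)        ≡⟨ by-cases β ⟩
  (if β then - sgn (size τ) else sgn (size τ)) ∎
  where
  open ≡-Reasoning
  by-cases : ∀ β → sgn (𝟙 β ℕ.+ size τ) ≡ (if β then - sgn (size τ) else sgn (size τ))
  by-cases false = refl
  by-cases true  = sgn-suc (size τ)

minor : ∀ {n} → Matrix (suc n) → Fin (suc n) → Matrix n
minor M j r c = M (suc r) (punchIn j c)

det-laplace : ∀ n (M : Matrix (suc n)) →
              det (suc n) M ≡ ∑ℤ (λ j → (sgn (toℕ j) * M zero j) * det n (minor M j))
det-laplace n M = ∑ℤ-allFin (suc n) (λ j → (sgn (toℕ j) * M zero j) * det n (minor M j))

det-cong : ∀ n {M N : Matrix n} → (∀ r j → M r j ≡ N r j) → det n M ≡ det n N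
det-cong zero e = refl
det-cong (suc n) {M} {N} e = begin
  det (suc n) M                                                   ≡⟨ det-laplace n M ⟩
  ∑ℤ (λ j → (sgn (toℕ j) * M zero j) * det n (minor M j))         ≡⟨ ℤ∑.sum-cong-≗ term ⟩
  ∑ℤ (λ j → (sgn (toℕ j) * N zero j) * det n (minor N j))         ≡⟨ det-laplace n N ⟨
  det (suc n) N                                                   ∎
  where
  open ≡-Reasoning
  term : ∀ j → (sgn (toℕ j) * M zero j) * det n (minor M j) ≡ (sgn (toℕ j) * N zero j) * det n (minor N j)
  term j = cong₂ _*_ (cong (sgn (toℕ j) *_) (e zero j)) (det-cong n (λ r c → e (suc r) (punchIn j c)))

rowSelect : ∀ {n} → Orientation n → Matrix n → Matrix n → Matrix n
rowSelect σ A B r j = if σ r then B r j else A r j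

det-row-difference : ∀ n (A B : Matrix n) →
  det n (λ r j → A r j - B r j) ≡ ∑ₒ n (λ σ → sgn (size σ) * det n (rowSelect σ A B))
det-row-difference zero A B = refl
det-row-difference (suc n) A B = begin
  det (suc n) (λ r j → A r j - B r j)
    ≡⟨ det-laplace n (λ r j → A r j - B r j) ⟩
  ∑ℤ (λ j → (s j * (A zero j - B zero j)) * det n (λ r c → minor A j r c - minor B j r c))
    ≡⟨ ℤ∑.sum-cong-≗ (λ j → cong ((s j * (A zero j - B zero j)) *_) (det-row-difference n (minor A j) (minor B j))) ⟩
  ∑ℤ (λ j → (s j * (A zero j - B zero j)) * ∑ₒ n (λ τ → g τ * d j τ))
    ≡⟨ ℤ∑.sum-cong-≗ (λ j → trans (sym (listSum-*ˡ (allOrientations n) (s j * (A zero j - B zero j)) (λ τ → g τ * d j τ)))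
                                   (listSum-cong (allOrientations n) (expand j))) ⟩
  ∑ℤ (λ j → ∑ₒ n (λ τ → both j τ))
    ≡⟨ listSum-comm-∑ℤ (allOrientations n) (λ τ j → both j τ) ⟨
  ∑ₒ n (λ τ → ∑ℤ (λ j → both j τ))
    ≡⟨ listSum-cong (allOrientations n) (λ τ → trans (ℤ∑.∑-distrib-+ (λ j → g τ * first A j τ) (λ j → (- g τ) * first B j τ))
         (sym (cong₂ _+_ (ℤ∑.*-distribˡ-sum (g τ) (λ j → first A j τ)) (ℤ∑.*-distribˡ-sum (- g τ) (λ j → first B j τ))))) ⟩
  ∑ₒ n (λ τ → g τ * ∑ℤ (λ j → first A j τ) + (- g τ) * ∑ℤ (λ j → first B j τ))
    ≡⟨ listSum-distrib-+ (allOrientations n) (λ τ → g τ * ∑ℤ (λ j → first A j τ))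
                                             (λ τ → (- g τ) * ∑ℤ (λ j → first B j τ)) ⟩
  ∑ₒ n (λ τ → g τ * ∑ℤ (λ j → first A j τ)) + ∑ₒ n (λ τ → (- g τ) * ∑ℤ (λ j → first B j τ))
    ≡⟨ cong₂ _+_ (listSum-cong (allOrientations n) (first-row false)) (listSum-cong (allOrientations n) (first-row true)) ⟩
  ∑ₒ n (λ τ → g (false Vector.∷ τ) * det (suc n) (rowSelect (false Vector.∷ τ) A B))
    + ∑ₒ n (λ τ → g (true Vector.∷ τ) * det (suc n) (rowSelect (true Vector.∷ τ) A B))
    ≡⟨ ∑ₒ-suc n (λ σ → g σ * det (suc n) (rowSelect σ A B)) ⟨
  ∑ₒ (suc n) (λ σ → g σ * det (suc n) (rowSelect σ A B)) ∎
  where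
  open ≡-Reasoning
  s : Fin (suc n) → ℤ
  s j = sgn (toℕ j)
  g : ∀ {m} → Orientation m → ℤ
  g τ = sgn (size τ)
  d : Fin (suc n) → Orientation n → ℤ
  d j τ = det n (rowSelect τ (minor A j) (minor B j))
  first : Matrix (suc n) → Fin (suc n) → Orientation n → ℤ
  first M j τ = (s j * M zero j) * d j τ
  both : Fin (suc n) → Orientation n → ℤ
  both j τ = g τ * first A j τ + (- g τ) * first B j τ
  first-row : ∀ β τ → (if β then - g τ else g τ) * ∑ℤ (λ j → first (if β then B else A) j τ)
                      ≡ g (β Vector.∷ τ) * det (suc n) (rowSelect (β Vector.∷ τ) A B)
  first-row false τ = cong₂ _*_ (sym (sgn-size-cons false τ)) (sym (det-laplace n (rowSelect (false Vector.∷ τ) A B)))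
  first-row true  τ = cong₂ _*_ (sym (sgn-size-cons true τ)) (sym (det-laplace n (rowSelect (true Vector.∷ τ) A B)))
  expand : ∀ j τ → (s j * (A zero j - B zero j)) * (g τ * d j τ) ≡ both j τ
  expand j τ = ring (s j) (A zero j) (B zero j) (g τ) (d j τ)
    where
    ring : ∀ s a b t x → (s * (a - b)) * (t * x) ≡ t * ((s * a) * x) + (- t) * ((s * b) * x)
    ring = solve-∀

det-zero-row : ∀ n (M : Matrix (suc n)) → (∀ j → M zero j ≡ 0ℤ) → det (suc n) M ≡ 0ℤ
det-zero-row n M z = begin
  det (suc n) M                                               ≡⟨ det-laplace n M ⟩
  ∑ℤ (λ j → (sgn (toℕ j) * M zero j) * det n (minor M j))     ≡⟨ ℤ∑.sum-cong-≗ vanish ⟩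
  ∑ℤ (λ (j : Fin (suc n)) → 0ℤ)                               ≡⟨ ℤ∑.sum-replicate-zero (suc n) ⟩
  0ℤ                                                          ∎
  where
  open ≡-Reasoning
  vanish : ∀ j → (sgn (toℕ j) * M zero j) * det n (minor M j) ≡ 0ℤ
  vanish j rewrite z j | ℤP.*-zeroʳ (sgn (toℕ j)) = refl

stepMatrix : ∀ {n} → (Fin n → ℕ) → Matrix n
stepMatrix c r j = 𝟙ℤ ⌊ c r ℕ.≤? toℕ j ⌋

-- Deleting column j from the row v[v, n] leaves the row v[collapse j v, n - 1].
collapse : ℕ → ℕ → ℕ
collapse j v = if ⌊ v ℕ.≤? j ⌋ then v else ℕ.pred v

toℕ-punchIn-< : ∀ {n} (i : Fin (suc n)) (j : Fin n) → toℕ j < toℕ i → toℕ (punchIn i j) ≡ toℕ j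
toℕ-punchIn-< (suc i) zero    _         = refl
toℕ-punchIn-< (suc i) (suc j) (s≤s j<i) = cong suc (toℕ-punchIn-< i j j<i)

toℕ-punchIn-≥ : ∀ {n} (i : Fin (suc n)) (j : Fin n) → toℕ i ≤ toℕ j → toℕ (punchIn i j) ≡ suc (toℕ j)
toℕ-punchIn-≥ zero    j       _         = refl
toℕ-punchIn-≥ (suc i) (suc j) (s≤s i≤j) = cong suc (toℕ-punchIn-≥ i j i≤j)

≤-punchIn : ∀ {n} v (j : Fin (suc n)) (x : Fin n) →
            ⌊ v ℕ.≤? toℕ (punchIn j x) ⌋ ≡ ⌊ collapse (toℕ j) v ℕ.≤? toℕ x ⌋
≤-punchIn v j x with v ℕ.≤? toℕ j | toℕ x ℕ.<? toℕ j
... | yes v≤j | yes x<j rewrite toℕ-punchIn-< j x x<j = refl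
... | yes v≤j | no  x≮j rewrite toℕ-punchIn-≥ j x (ℕP.≮⇒≥ x≮j) =
  ⌊⌋-⇔ (λ _ → ℕP.≤-trans v≤j (ℕP.≮⇒≥ x≮j)) ℕP.m≤n⇒m≤1+n _ _
... | no  v≰j | yes x<j rewrite toℕ-punchIn-< j x x<j =
  ⌊⌋-⇔ (λ v≤x → ⊥-elim (v≰j (ℕP.≤-trans v≤x (ℕP.<⇒≤ x<j))))
       (λ v-1≤x → ⊥-elim (v≰j (pred≤ v v-1≤x x<j))) _ _
  where
  pred≤ : ∀ v {j x} → ℕ.pred v ≤ x → x < j → v ≤ j
  pred≤ zero    _ _ = z≤n
  pred≤ (suc v) p q = ℕP.≤-trans (s≤s p) q
... | no  v≰j | no  x≮j rewrite toℕ-punchIn-≥ j x (ℕP.≮⇒≥ x≮j) = pred-≤ v v≰j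
  where
  pred-≤ : ∀ v → ¬ v ≤ toℕ j → ⌊ v ℕ.≤? suc (toℕ x) ⌋ ≡ ⌊ ℕ.pred v ℕ.≤? toℕ x ⌋
  pred-≤ zero    v≰j = ⊥-elim (v≰j z≤n)
  pred-≤ (suc v) _   = ⌊⌋-⇔ ℕP.≤-pred s≤s _ _

minor-stepMatrix : ∀ {n} (c : Fin (suc n) → ℕ) j r x →
                   minor (stepMatrix c) j r x ≡ stepMatrix (collapse (toℕ j) ∘ c ∘ suc) r x
minor-stepMatrix c j r x = cong 𝟙ℤ (≤-punchIn (c (suc r)) j x)

≤-split : ∀ k m → 𝟙ℤ ⌊ k ℕ.≤? m ⌋ ≡ 𝟙ℤ ⌊ m ℕ.≟ k ⌋ + 𝟙ℤ ⌊ suc k ℕ.≤? m ⌋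
≤-split k m with k ℕ.≤? m | m ℕ.≟ k | suc k ℕ.≤? m
... | yes _   | yes m≡k | yes k<m = ⊥-elim (ℕP.<-irrefl (sym m≡k) k<m)
... | yes _   | yes _   | no  _   = refl
... | yes _   | no  _   | yes _   = refl
... | yes k≤m | no  m≢k | no  k≮m = ⊥-elim (m≢k (ℕP.≤-antisym (ℕP.≮⇒≥ k≮m) k≤m))
... | no  k≰m | yes m≡k | _       = ⊥-elim (k≰m (ℕP.≤-reflexive (sym m≡k)))
... | no  k≰m | no  _   | yes k<m = ⊥-elim (k≰m (ℕP.<⇒≤ k<m))
... | no  _   | no  _   | no  _   = refl

𝟙ℤ-* : ∀ β x → 𝟙ℤ β * x ≡ (if β then x else 0ℤ)
𝟙ℤ-* true  x = ℤP.*-identityˡ x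
𝟙ℤ-* false x = refl

∑ℤ-diagonal : ∀ n k → k < n → (F : ℕ → ℤ) →
              ∑ℤ (λ (j : Fin n) → if ⌊ toℕ j ℕ.≟ k ⌋ then F (toℕ j) else 0ℤ) ≡ F k
∑ℤ-diagonal (suc n) zero _ F = begin
  F 0 + ∑ℤ (λ (j : Fin n) → 0ℤ)    ≡⟨ cong (F 0 +_) (ℤ∑.sum-replicate-zero n) ⟩
  F 0 + 0ℤ                         ≡⟨ ℤP.+-identityʳ (F 0) ⟩
  F 0                              ∎
  where open ≡-Reasoning
∑ℤ-diagonal (suc n) (suc k) (s≤s k<n) F = begin
  0ℤ + ∑ℤ shifted    ≡⟨ ℤP.+-identityˡ (∑ℤ shifted) ⟩
  ∑ℤ shifted         ≡⟨ ℤ∑.sum-cong-≗ unshift ⟩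
  ∑ℤ unshifted       ≡⟨ ∑ℤ-diagonal n k k<n (F ∘ suc) ⟩
  F (suc k)          ∎
  where
  open ≡-Reasoning
  shifted unshifted : Fin n → ℤ
  shifted j = if ⌊ suc (toℕ j) ℕ.≟ suc k ⌋ then F (suc (toℕ j)) else 0ℤ
  unshifted j = if ⌊ toℕ j ℕ.≟ k ⌋ then F (suc (toℕ j)) else 0ℤ
  unshift : ∀ j → shifted j ≡ unshifted j
  unshift j = cong (λ β → if β then F (suc (toℕ j)) else 0ℤ) (⌊⌋-⇔ ℕP.suc-injective (cong suc) _ (toℕ j ℕ.≟ k))

det-stepMatrix-laplace : ∀ {n} (c : Fin (suc n) → ℕ) →
  det (suc n) (stepMatrix c)
    ≡ ∑ℤ (λ (j : Fin (suc n)) → (sgn (toℕ j) * 𝟙ℤ ⌊ c zero ℕ.≤? toℕ j ⌋)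
                                 * det n (stepMatrix (collapse (toℕ j) ∘ c ∘ suc)))
det-stepMatrix-laplace {n} c = trans (det-laplace n (stepMatrix c)) (ℤ∑.sum-cong-≗ minors)
  where
  minors : ∀ j → (sgn (toℕ j) * 𝟙ℤ ⌊ c zero ℕ.≤? toℕ j ⌋) * det n (minor (stepMatrix c) j)
               ≡ (sgn (toℕ j) * 𝟙ℤ ⌊ c zero ℕ.≤? toℕ j ⌋) * det n (stepMatrix (collapse (toℕ j) ∘ c ∘ suc))
  minors j = cong ((sgn (toℕ j) * 𝟙ℤ ⌊ c zero ℕ.≤? toℕ j ⌋) *_) (det-cong n (minor-stepMatrix c j))

-- The first row v[k, n] is the unit row e_k plus v[k + 1, n].
det-stepMatrix-split : ∀ {n} (c : Fin (suc n) → ℕ) → c zero < suc n →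
  det (suc n) (stepMatrix c)
    ≡ sgn (c zero) * det n (stepMatrix (collapse (c zero) ∘ c ∘ suc))
      + det (suc n) (stepMatrix (suc (c zero) Vector.∷ c ∘ suc))
det-stepMatrix-split {n} c k<1+n = begin
  det (suc n) (stepMatrix c)
    ≡⟨ det-stepMatrix-laplace c ⟩
  ∑ℤ (λ (j : Fin (suc n)) → (s j * 𝟙ℤ ⌊ k ℕ.≤? toℕ j ⌋) * D (toℕ j))
    ≡⟨ ℤ∑.sum-cong-≗ (λ j → trans (cong (λ x → (s j * x) * D (toℕ j)) (≤-split k (toℕ j)))
                                   (ring (s j) (𝟙ℤ ⌊ toℕ j ℕ.≟ k ⌋) _ (D (toℕ j)))) ⟩
  ∑ℤ (λ j → unit j + rest j)
    ≡⟨ ℤ∑.∑-distrib-+ unit rest ⟩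
  ∑ℤ unit + ∑ℤ rest
    ≡⟨ cong₂ _+_ (trans (ℤ∑.sum-cong-≗ (λ j → 𝟙ℤ-* ⌊ toℕ j ℕ.≟ k ⌋ (s j * D (toℕ j))))
                        (∑ℤ-diagonal (suc n) k k<1+n (λ m → sgn m * D m)))
                 (sym (det-stepMatrix-laplace (suc k Vector.∷ c ∘ suc))) ⟩
  sgn k * D k + det (suc n) (stepMatrix (suc k Vector.∷ c ∘ suc)) ∎
  where
  open ≡-Reasoning
  k = c zero
  s : Fin (suc n) → ℤ
  s j = sgn (toℕ j)
  D : ℕ → ℤ
  D m = det n (stepMatrix (collapse m ∘ c ∘ suc))
  unit rest : Fin (suc n) → ℤ
  unit j = 𝟙ℤ ⌊ toℕ j ℕ.≟ k ⌋ * (s j * D (toℕ j))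
  rest j = (s j * 𝟙ℤ ⌊ suc k ℕ.≤? toℕ j ⌋) * D (toℕ j)
  ring : ∀ s a b x → (s * (a + b)) * x ≡ a * (s * x) + (s * b) * x
  ring = solve-∀

det-stepMatrix-vanish : ∀ {n} (c : Fin (suc n) → ℕ) → suc n ≤ c zero → det (suc n) (stepMatrix c) ≡ 0ℤ
det-stepMatrix-vanish {n} c n<k = det-zero-row n (stepMatrix c) λ j →
  cong 𝟙ℤ (⌊⌋-false (c zero ℕ.≤? toℕ j) (ℕP.<⇒≱ (ℕP.<-≤-trans (FinP.toℕ<n j) n<k)))

Injective : ∀ {n} {A : Set} → (Fin n → A) → Set
Injective c = ∀ r s → c r ≡ c s → r ≡ s

IsPermutation : ∀ {n} → (Fin n → ℕ) → Set
IsPermutation {n} c = (∀ r → c r < n) × Injective c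

-- isPermutation? and inversions repeat good? and inv verbatim, so that Good P σ is
-- IsPermutation (src P σ) and inv P σ is inversions (src P σ) by definition.
isPermutation? : ∀ {n} (c : Fin n → ℕ) → Dec (IsPermutation c)
isPermutation? {n} c =
  FinP.all? (λ r → c r ℕ.<? n)
  Dec.×-dec FinP.all? (λ r → FinP.all? (λ s → (c r ℕ.≟ c s) Dec.→-dec (r FinP.≟ s)))

inversions : ∀ {n} → (Fin n → ℕ) → ℕ
inversions {n} c =
  sumℕ (map (λ r → sumℕ (map (λ s →
      if ⌊ r FinP.<? s ⌋ ∧ ⌊ c s ℕ.<? c r ⌋ then 1 else 0)
    (allFin n))) (allFin n))

permSign : ∀ {n} → (Fin n → ℕ) → ℤ
permSign c = if ⌊ isPermutation? c ⌋ then sgn (inversions c) else 0ℤ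

permSign-perm : ∀ {n} (c : Fin n → ℕ) → IsPermutation c → permSign c ≡ sgn (inversions c)
permSign-perm c p rewrite ⌊⌋-true (isPermutation? c) p = refl

permSign-nonperm : ∀ {n} (c : Fin n → ℕ) → ¬ IsPermutation c → permSign c ≡ 0ℤ
permSign-nonperm c ¬p rewrite ⌊⌋-false (isPermutation? c) ¬p = refl

inverted : ∀ {n} → (Fin n → ℕ) → Fin n → Fin n → ℕ
inverted c r s = 𝟙 (⌊ r FinP.<? s ⌋ ∧ ⌊ c s ℕ.<? c r ⌋)

inversions-∑ : ∀ {n} (c : Fin n → ℕ) → inversions c ≡ ∑∑ (inverted c)
inversions-∑ {n} c = trans (∑ℕ-allFin n (λ r → sumℕ (map (inverted c r) (allFin n))))
                           (ℕ∑.sum-cong-≗ (λ r → ∑ℕ-allFin n (inverted c r)))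

inversions-cong-< : ∀ {n} (c d : Fin n → ℕ) → (∀ r s → c s < c r → d s < d r) → (∀ r s → d s < d r → c s < c r) →
                    inversions c ≡ inversions d
inversions-cong-< c d c⇒d d⇒c = begin
  inversions c                        ≡⟨ inversions-∑ c ⟩
  ∑∑ (inverted c)                     ≡⟨ ℕ∑.sum-cong-≗ (λ r → ℕ∑.sum-cong-≗ (same r)) ⟩
  ∑∑ (inverted d)                     ≡⟨ inversions-∑ d ⟨
  inversions d                        ∎
  where
  open ≡-Reasoning
  same : ∀ r s → inverted c r s ≡ inverted d r s
  same r s = cong (λ β → 𝟙 (⌊ r FinP.<? s ⌋ ∧ β)) (⌊⌋-⇔ (c⇒d r s) (d⇒c r s) _ _)

inversions-cong : ∀ {n} (c d : Fin n → ℕ) → c ≗ d → inversions c ≡ inversions d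
inversions-cong c d c≗d = inversions-cong-< c d (λ r s → subst₂ _<_ (c≗d s) (c≗d r))
                                                 (λ r s → subst₂ _<_ (sym (c≗d s)) (sym (c≗d r)))

below : ∀ {n} → (Fin n → ℕ) → ℕ → ℕ
below c x = ∑ℕ (λ s → 𝟙 ⌊ c s ℕ.<? x ⌋)

inversions-suc : ∀ {n} (c : Fin (suc n) → ℕ) → inversions c ≡ below (c ∘ suc) (c zero) ℕ.+ inversions (c ∘ suc)
inversions-suc {n} c = trans (inversions-∑ c) (cong₂ ℕ._+_ first-row (trans other-rows (sym (inversions-∑ (c ∘ suc)))))
  where
  first-row : ∑ℕ (inverted c zero) ≡ below (c ∘ suc) (c zero)
  first-row = refl
  other-rows : ∑ℕ (λ r → ∑ℕ (inverted c (suc r))) ≡ ∑ℕ (λ r → ∑ℕ (inverted (c ∘ suc) r))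
  other-rows = ℕ∑.sum-cong-≗ λ r → ℕ∑.sum-cong-≗ λ s →
    cong (λ β → 𝟙 (β ∧ ⌊ c (suc s) ℕ.<? c (suc r) ⌋)) (⌊⌋-⇔ ℕP.≤-pred s≤s (suc r FinP.<? suc s) (r FinP.<? s))

hits : ∀ {n} → (Fin n → ℕ) → ℕ → ℕ
hits c x = ∑ℕ (λ s → 𝟙 ⌊ c s ℕ.≟ x ⌋)

below-suc : ∀ {n} (c : Fin n → ℕ) x → below c (suc x) ≡ below c x ℕ.+ hits c x
below-suc c x = trans (ℕ∑.sum-cong-≗ (λ s → split (c s)))
                      (ℕ∑.∑-distrib-+ (λ s → 𝟙 ⌊ c s ℕ.<? x ⌋) (λ s → 𝟙 ⌊ c s ℕ.≟ x ⌋))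
  where
  split : ∀ v → 𝟙 ⌊ v ℕ.<? suc x ⌋ ≡ 𝟙 ⌊ v ℕ.<? x ⌋ ℕ.+ 𝟙 ⌊ v ℕ.≟ x ⌋
  split v with ℕP.<-cmp v x
  ... | tri< v<x v≢x _ rewrite ⌊⌋-true (v ℕ.<? suc x) (ℕP.m<n⇒m<1+n v<x) | ⌊⌋-true (v ℕ.<? x) v<x
                             | ⌊⌋-false (v ℕ.≟ x) v≢x = refl
  ... | tri≈ _ v≡x _   rewrite ⌊⌋-true (v ℕ.<? suc x) (s≤s (ℕP.≤-reflexive v≡x)) | ⌊⌋-false (v ℕ.<? x) (ℕP.<-irrefl v≡x)
                             | ⌊⌋-true (v ℕ.≟ x) v≡x = refl
  ... | tri> _ v≢x x<v rewrite ⌊⌋-false (v ℕ.<? suc x) (ℕP.<⇒≱ (s≤s x<v)) | ⌊⌋-false (v ℕ.<? x) (ℕP.<-asym x<v)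
                             | ⌊⌋-false (v ℕ.≟ x) v≢x = refl

hits-absent : ∀ {n} (c : Fin n → ℕ) x → (∀ s → c s ≢ x) → hits c x ≡ 0
hits-absent {n} c x absent = trans (ℕ∑.sum-cong-≗ (λ s → cong 𝟙 (⌊⌋-false (c s ℕ.≟ x) (absent s))))
                               (ℕ∑.sum-replicate-zero n)

hits-injective : ∀ {n} (c : Fin n → ℕ) x → Injective c → hits c x ≤ 1
hits-injective {zero}  c x inj = z≤n
hits-injective {suc n} c x inj with c zero ℕ.≟ x
... | yes c₀≡x = ℕP.≤-reflexive (cong suc (hits-absent (c ∘ suc) x λ s cₛ≡x →
                   FinP.0≢1+n (inj zero (suc s) (trans c₀≡x (sym cₛ≡x)))))
... | no  _    = hits-injective (c ∘ suc) x (λ r s e → FinP.suc-injective (inj (suc r) (suc s) e))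

below-+ : ∀ {n} (c : Fin n → ℕ) x d → Injective c → below c (x ℕ.+ d) ≤ below c x ℕ.+ d
below-+ c x zero    inj rewrite ℕP.+-identityʳ x | ℕP.+-identityʳ (below c x) = ℕP.≤-refl
below-+ c x (suc d) inj rewrite ℕP.+-suc x d | ℕP.+-suc (below c x) d | below-suc c (x ℕ.+ d) = begin
  below c (x ℕ.+ d) ℕ.+ hits c (x ℕ.+ d) ≤⟨ ℕP.+-mono-≤ (below-+ c x d inj) (hits-injective c (x ℕ.+ d) inj) ⟩
  below c x ℕ.+ d ℕ.+ 1                  ≡⟨ ℕP.+-comm _ 1 ⟩
  suc (below c x ℕ.+ d)                  ∎
  where open ℕP.≤-Reasoning

below-zero : ∀ {n} (c : Fin n → ℕ) → below c 0 ≡ 0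
below-zero {n} c = trans (ℕ∑.sum-cong-≗ (λ s → cong 𝟙 (⌊⌋-false (c s ℕ.<? 0) λ ()))) (ℕ∑.sum-replicate-zero n)

below-perm : ∀ {n} (c : Fin n → ℕ) → IsPermutation c → ∀ x → x ≤ n → below c x ≡ x
below-perm {n} c (bounded , inj) x x≤n = ℕP.≤-antisym at-most at-least
  where
  open ℕP.≤-Reasoning
  at-most : below c x ≤ x
  at-most = subst (below c x ≤_) (cong (ℕ._+ x) (below-zero c)) (below-+ c 0 x inj)
  below-all : below c n ≡ n
  below-all = trans (ℕ∑.sum-cong-≗ (λ s → cong 𝟙 (⌊⌋-true (c s ℕ.<? n) (bounded s)))) (∑ℕ-ones n)
  at-least : x ≤ below c x
  at-least = ℕP.+-cancelʳ-≤ (n ℕ.∸ x) x (below c x) (begin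
    x ℕ.+ (n ℕ.∸ x)            ≡⟨ ℕP.m+[n∸m]≡n x≤n ⟩
    n                          ≡⟨ below-all ⟨
    below c n                  ≡⟨ cong (below c) (ℕP.m+[n∸m]≡n x≤n) ⟨
    below c (x ℕ.+ (n ℕ.∸ x))  ≤⟨ below-+ c x (n ℕ.∸ x) inj ⟩
    below c x ℕ.+ (n ℕ.∸ x)    ∎)

perm-surjective : ∀ {n} (c : Fin n → ℕ) → IsPermutation c → ∀ x → x < n → ∃ λ r → c r ≡ x
perm-surjective {n} c perm x x<n with FinP.any? (λ r → c r ℕ.≟ x)
... | yes hit = hit
... | no  ¬hit = ⊥-elim (ℕP.1+n≢n (begin
  suc x                      ≡⟨ below-perm c perm (suc x) x<n ⟨
  below c (suc x)            ≡⟨ below-suc c x ⟩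
  below c x ℕ.+ hits c x     ≡⟨ cong₂ ℕ._+_ (below-perm c perm x (ℕP.<⇒≤ x<n)) (hits-absent c x (λ s e → ¬hit (s , e))) ⟩
  x ℕ.+ 0                    ≡⟨ ℕP.+-identityʳ x ⟩
  x                          ∎))
  where open ≡-Reasoning

collapse-cases : ∀ k v → (v ≤ k × collapse k v ≡ v) ⊎ (Σ ℕ λ v' → v ≡ suc v' × k ≤ v' × collapse k v ≡ v')
collapse-cases k v with v ℕ.≤? k
... | yes v≤k = inj₁ (v≤k , refl)
collapse-cases k zero    | no v≰k = ⊥-elim (v≰k z≤n)
collapse-cases k (suc v) | no v≰k = inj₂ (v , refl , ℕP.≮⇒≥ v≰k , refl)

collapse-self : ∀ k → collapse k k ≡ k
collapse-self k rewrite ⌊⌋-true (k ℕ.≤? k) ℕP.≤-refl = refl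

collapse-suc-self : ∀ k → collapse k (suc k) ≡ k
collapse-suc-self k rewrite ⌊⌋-false (suc k ℕ.≤? k) (ℕP.<-irrefl refl) = refl

collapse-< : ∀ N k v → v < suc N → (v ≤ k → v < N) → collapse k v < N
collapse-< N k v v<1+N small with collapse-cases k v
... | inj₁ (v≤k , e)           rewrite e = small v≤k
... | inj₂ (v' , refl , _ , e) rewrite e = ℕP.≤-pred v<1+N

collapse-<-reflect : ∀ N k v → collapse k v < N → v < suc N
collapse-<-reflect N k v lt with collapse-cases k v
... | inj₁ (_ , e)             rewrite e = ℕP.m≤n⇒m≤1+n lt
... | inj₂ (v' , refl , _ , e) rewrite e = s≤s lt

collapse-reflects-< : ∀ k u v → collapse k v < collapse k u → v < u
collapse-reflects-< k u v lt with collapse-cases k u | collapse-cases k v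
... | inj₁ (_ , eu)             | inj₁ (_ , ev)             rewrite eu | ev = lt
... | inj₂ (_ , refl , _ , eu)  | inj₂ (_ , refl , _ , ev)  rewrite eu | ev = s≤s lt
... | inj₂ (_ , refl , k≤u' , _) | inj₁ (v≤k , _)           = s≤s (ℕP.≤-trans v≤k k≤u')
... | inj₁ (u≤k , eu)           | inj₂ (_ , refl , k≤v' , ev) rewrite eu | ev =
  ⊥-elim (ℕP.<⇒≱ lt (ℕP.≤-trans u≤k k≤v'))

collapse-preserves-< : ∀ k u v → ¬ (u ≡ suc k × v ≡ k) → v < u → collapse k v < collapse k u
collapse-preserves-< k u v not-merged lt with collapse-cases k u | collapse-cases k v
... | inj₁ (_ , eu)             | inj₁ (_ , ev)              rewrite eu | ev = lt
... | inj₂ (_ , refl , _ , eu)  | inj₂ (_ , refl , _ , ev)   rewrite eu | ev = ℕP.≤-pred lt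
... | inj₁ (u≤k , _)            | inj₂ (_ , refl , k≤v' , _) = ⊥-elim (ℕP.<⇒≱ lt (ℕP.≤-trans u≤k (ℕP.m≤n⇒m≤1+n k≤v')))
... | inj₂ (u' , refl , k≤u' , eu) | inj₁ (v≤k , ev)         rewrite eu | ev =
  ℕP.≤∧≢⇒< (ℕP.≤-trans v≤k k≤u') λ v≡u' →
    not-merged (cong suc (ℕP.≤-antisym (subst (_≤ k) v≡u' v≤k) k≤u') , ℕP.≤-antisym v≤k (subst (k ≤_) (sym v≡u') k≤u'))

collapse-injective : ∀ k u v → ¬ (u ≡ suc k × v ≡ k) → ¬ (u ≡ k × v ≡ suc k) → collapse k u ≡ collapse k v → u ≡ v
collapse-injective k u v ¬uv ¬vu e with ℕP.<-cmp u v
... | tri< u<v _ _ = ⊥-elim (ℕP.<-irrefl e (collapse-preserves-< k v u (λ (p , q) → ¬vu (q , p)) u<v))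
... | tri≈ _ u≡v _ = u≡v
... | tri> _ _ v<u = ⊥-elim (ℕP.<-irrefl (sym e) (collapse-preserves-< k u v ¬uv v<u))

inversions-collapse : ∀ {n} k (T : Fin n → ℕ) → (∀ r s → T r ≡ suc k → T s ≡ k → ⊥) →
                      inversions (collapse k ∘ T) ≡ inversions T
inversions-collapse k T not-both = inversions-cong-< (collapse k ∘ T) T
  (λ r s → collapse-reflects-< k (T r) (T s))
  (λ r s → collapse-preserves-< k (T r) (T s) (λ (p , q) → not-both r s p q))

module _ {N : ℕ} (c : Fin (suc N) → ℕ) where
  private
    k = c zero
    T : Fin N → ℕ
    T = c ∘ suc

  collapse-tail-perm : IsPermutation c → IsPermutation (collapse k ∘ T)
  collapse-tail-perm (bounded , inj) = bounded′ , inj′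
    where
    T≢k : ∀ r → T r ≢ k
    T≢k r e = FinP.0≢1+n (sym (inj (suc r) zero e))
    bounded′ : ∀ r → collapse k (T r) < N
    bounded′ r = collapse-< N k (T r) (bounded (suc r))
                   (λ T≤k → ℕP.<-≤-trans (ℕP.≤∧≢⇒< T≤k (T≢k r)) (ℕP.≤-pred (bounded zero)))
    inj′ : Injective (collapse k ∘ T)
    inj′ r s e = FinP.suc-injective (inj (suc r) (suc s)
                   (collapse-injective k (T r) (T s) (λ (_ , q) → T≢k s q) (λ (p , _) → T≢k r p) e))

  bumped-nonperm : IsPermutation c → ¬ IsPermutation (suc k Vector.∷ T)
  bumped-nonperm perm (bounded′ , inj′) with perm-surjective c perm (suc k) (bounded′ zero)
  ... | zero  , e = ℕP.1+n≢n (sym e)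
  ... | suc r , e = FinP.0≢1+n (inj′ zero (suc r) (sym e))

  module _ (k<1+N : k < suc N) where

    bumped-perm : ¬ IsPermutation c → IsPermutation (collapse k ∘ T) → IsPermutation (suc k Vector.∷ T)
    bumped-perm ¬perm (bounded′ , inj′) = bounded , inj
      where
      T-injective : Injective T
      T-injective r s e = inj′ r s (cong (collapse k) e)
      k-hit : ∃ λ r → T r ≡ k
      k-hit with FinP.any? (λ r → T r ℕ.≟ k)
      ... | yes hit = hit
      ... | no ¬hit = ⊥-elim (¬perm (c-bounded , c-inj))
        where
        c-bounded : ∀ r → c r < suc N
        c-bounded zero    = k<1+N
        c-bounded (suc r) = collapse-<-reflect N k (T r) (bounded′ r)
        c-inj : Injective c
        c-inj zero    zero    e = refl
        c-inj zero    (suc s) e = ⊥-elim (¬hit (s , sym e))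
        c-inj (suc r) zero    e = ⊥-elim (¬hit (r , e))
        c-inj (suc r) (suc s) e = cong suc (T-injective r s e)
      r₀ = proj₁ k-hit
      T≢1+k : ∀ s → T s ≢ suc k
      T≢1+k s e = ℕP.1+n≢n (trans (sym e) (trans (cong T s≡r₀) (proj₂ k-hit)))
        where
        s≡r₀ : s ≡ r₀
        s≡r₀ = inj′ s r₀ (trans (cong (collapse k) e)
                 (trans (collapse-suc-self k) (sym (trans (cong (collapse k) (proj₂ k-hit)) (collapse-self k)))))
      bounded : ∀ r → (suc k Vector.∷ T) r < suc N
      bounded zero    = s≤s (subst (_< N) (trans (cong (collapse k) (proj₂ k-hit)) (collapse-self k)) (bounded′ r₀))
      bounded (suc r) = collapse-<-reflect N k (T r) (bounded′ r)
      inj : Injective (suc k Vector.∷ T)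
      inj zero    zero    e = refl
      inj zero    (suc s) e = ⊥-elim (T≢1+k s (sym e))
      inj (suc r) zero    e = ⊥-elim (T≢1+k r e)
      inj (suc r) (suc s) e = cong suc (T-injective r s e)

  bumped-perm⇒collapse-tail-perm : IsPermutation (suc k Vector.∷ T) → IsPermutation (collapse k ∘ T)
  bumped-perm⇒collapse-tail-perm (bounded , inj) = bounded′ , inj′
    where
    T≢1+k : ∀ s → T s ≢ suc k
    T≢1+k s e = FinP.0≢1+n (inj zero (suc s) (sym e))
    bounded′ : ∀ r → collapse k (T r) < N
    bounded′ r = collapse-< N k (T r) (bounded (suc r)) (λ T≤k → ℕP.≤-<-trans T≤k (ℕP.≤-pred (bounded zero)))
    inj′ : Injective (collapse k ∘ T)
    inj′ r s e = FinP.suc-injective (inj (suc r) (suc s)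
                   (collapse-injective k (T r) (T s) (λ (p , _) → T≢1+k r p) (λ (_ , q) → T≢1+k s q) e))

inversions-perm-suc : ∀ {N} (d : Fin (suc N) → ℕ) → IsPermutation d → inversions d ≡ d zero ℕ.+ inversions (d ∘ suc)
inversions-perm-suc d perm = trans (inversions-suc d) (cong (ℕ._+ inversions (d ∘ suc)) smaller-in-tail)
  where
  smaller-in-tail : below (d ∘ suc) (d zero) ≡ d zero
  smaller-in-tail = trans (cong (λ β → 𝟙 β ℕ.+ below (d ∘ suc) (d zero)) (sym (⌊⌋-false (d zero ℕ.<? d zero) (ℕP.<-irrefl refl))))
                          (below-perm d perm (d zero) (ℕP.<⇒≤ (proj₁ perm zero)))

sgn-cancel : ∀ k i → sgn k * sgn i + sgn (suc k ℕ.+ i) ≡ 0ℤ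
sgn-cancel k i = begin
  sgn k * sgn i + sgn (suc k ℕ.+ i)   ≡⟨ cong (sgn k * sgn i +_) (sgn-suc (k ℕ.+ i)) ⟩
  sgn k * sgn i + - sgn (k ℕ.+ i)     ≡⟨ cong (λ x → sgn k * sgn i + - x) (sgn-+ k i) ⟩
  sgn k * sgn i + - (sgn k * sgn i)   ≡⟨ ℤP.+-inverseʳ (sgn k * sgn i) ⟩
  0ℤ                                  ∎
  where open ≡-Reasoning

permSign-split : ∀ {N} (c : Fin (suc N) → ℕ) → c zero < suc N →
  permSign c ≡ sgn (c zero) * permSign (collapse (c zero) ∘ c ∘ suc) + permSign (suc (c zero) Vector.∷ c ∘ suc)
permSign-split c k<1+N = by-cases (isPermutation? c) (isPermutation? c′)
  where
  open ≡-Reasoning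
  k = c zero
  T = c ∘ suc
  c′ = collapse k ∘ T
  u = suc k Vector.∷ T
  by-cases : Dec (IsPermutation c) → Dec (IsPermutation c′) → permSign c ≡ sgn k * permSign c′ + permSign u
  by-cases (yes perm) _ = begin
    permSign c                                ≡⟨ permSign-perm c perm ⟩
    sgn (inversions c)                        ≡⟨ cong sgn (inversions-perm-suc c perm) ⟩
    sgn (k ℕ.+ inversions T)                  ≡⟨ cong (λ i → sgn (k ℕ.+ i)) (inversions-collapse k T T-misses-k) ⟨
    sgn (k ℕ.+ inversions c′)                 ≡⟨ sgn-+ k (inversions c′) ⟩
    sgn k * sgn (inversions c′)               ≡⟨ ℤP.+-identityʳ _ ⟨
    sgn k * sgn (inversions c′) + 0ℤ          ≡⟨ cong₂ (λ x y → sgn k * x + y) (permSign-perm c′ (collapse-tail-perm c perm))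
                                                                              (permSign-nonperm u (bumped-nonperm c perm)) ⟨
    sgn k * permSign c′ + permSign u          ∎
    where
    T-misses-k : ∀ r s → T r ≡ suc k → T s ≡ k → ⊥
    T-misses-k r s _ e = FinP.0≢1+n (sym (proj₂ perm (suc s) zero e))
  by-cases (no ¬perm) (yes perm′) = begin
    permSign c
      ≡⟨ permSign-nonperm c ¬perm ⟩
    0ℤ
      ≡⟨ sgn-cancel k (inversions c′) ⟨
    sgn k * sgn (inversions c′) + sgn (suc k ℕ.+ inversions c′)
      ≡⟨ cong (λ i → sgn k * sgn (inversions c′) + sgn (suc k ℕ.+ i)) (inversions-collapse k T T-misses-1+k) ⟩
    sgn k * sgn (inversions c′) + sgn (suc k ℕ.+ inversions T)
      ≡⟨ cong (λ i → sgn k * sgn (inversions c′) + sgn i) (inversions-perm-suc u permᵤ) ⟨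
    sgn k * sgn (inversions c′) + sgn (inversions u)
      ≡⟨ cong₂ (λ x y → sgn k * x + y) (permSign-perm c′ perm′) (permSign-perm u permᵤ) ⟨
    sgn k * permSign c′ + permSign u ∎
    where
    permᵤ : IsPermutation u
    permᵤ = bumped-perm c k<1+N ¬perm perm′
    T-misses-1+k : ∀ r s → T r ≡ suc k → T s ≡ k → ⊥
    T-misses-1+k r s e _ = FinP.0≢1+n (proj₂ permᵤ zero (suc r) (sym e))
  by-cases (no ¬perm) (no ¬perm′) = begin
    permSign c                                ≡⟨ permSign-nonperm c ¬perm ⟩
    0ℤ                                        ≡⟨ cong (_+ 0ℤ) (ℤP.*-zeroʳ (sgn k)) ⟨
    sgn k * 0ℤ + 0ℤ                           ≡⟨ cong₂ (λ x y → sgn k * x + y) (permSign-nonperm c′ ¬perm′)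
                                                   (permSign-nonperm u (¬perm′ ∘ bumped-perm⇒collapse-tail-perm c)) ⟨
    sgn k * permSign c′ + permSign u          ∎

det-stepMatrix : ∀ n (c : Fin n → ℕ) → det n (stepMatrix c) ≡ permSign c
det-stepMatrix zero    c = sym (permSign-perm c ((λ ()) , (λ ())))
det-stepMatrix (suc n) c = bumping (suc n ℕ.∸ c zero) c refl
  -- replacing the first row v[k, n] by v[k + 1, n] decreases suc n ∸ k
  where
  bumping : ∀ m (c : Fin (suc n) → ℕ) → suc n ℕ.∸ c zero ≡ m → det (suc n) (stepMatrix c) ≡ permSign c
  bumping zero c e = trans (det-stepMatrix-vanish c n<k) (sym (permSign-nonperm c (λ p → ℕP.<⇒≱ (proj₁ p zero) n<k)))
    where
    n<k : suc n ≤ c zero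
    n<k = ℕP.m∸n≡0⇒m≤n e
  bumping (suc m) c e = begin
    det (suc n) (stepMatrix c)
      ≡⟨ det-stepMatrix-split c k<1+n ⟩
    sgn (c zero) * det n (stepMatrix (collapse (c zero) ∘ c ∘ suc)) + det (suc n) (stepMatrix (suc (c zero) Vector.∷ c ∘ suc))
      ≡⟨ cong₂ (λ x y → sgn (c zero) * x + y) (det-stepMatrix n (collapse (c zero) ∘ c ∘ suc))
                                             (bumping m (suc (c zero) Vector.∷ c ∘ suc) e′) ⟩
    sgn (c zero) * permSign (collapse (c zero) ∘ c ∘ suc) + permSign (suc (c zero) Vector.∷ c ∘ suc)
      ≡⟨ permSign-split c k<1+n ⟨
    permSign c ∎
    where
    open ≡-Reasoning
    k<1+n : c zero < suc n
    k<1+n = ℕP.m∸n≢0⇒n<m (λ e₀ → ℕP.1+n≢0 (trans (sym e) e₀))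
    e′ : n ℕ.∸ c zero ≡ m
    e′ = ℕP.suc-injective (trans (sym (ℕP.+-∸-assoc 1 (ℕP.≤-pred k<1+n))) e)

petrieMatrix-row-difference : ∀ {n} (P : PetrieData n) r j →
                             petrieMatrix P r j ≡ stepMatrix (a P) r j - stepMatrix (b P) r j
petrieMatrix-row-difference P r j = interval (a P r) (b P r) (toℕ j) (a≤b P r)
  where
  interval : ∀ a b j → a ≤ b →
             (if ⌊ a ℕ.≤? j ⌋ ∧ ⌊ j ℕ.<? b ⌋ then 1ℤ else 0ℤ) ≡ 𝟙ℤ ⌊ a ℕ.≤? j ⌋ - 𝟙ℤ ⌊ b ℕ.≤? j ⌋
  interval a b j a≤b with a ℕ.≤? j | j ℕ.<? b | b ℕ.≤? j
  ... | yes _   | yes j<b | yes b≤j = ⊥-elim (ℕP.<⇒≱ j<b b≤j)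
  ... | yes _   | yes _   | no  _   = refl
  ... | yes _   | no  _   | yes _   = refl
  ... | yes _   | no  j≮b | no  b≰j = ⊥-elim (j≮b (ℕP.≰⇒> b≰j))
  ... | no  a≰j | _       | yes b≤j = ⊥-elim (a≰j (ℕP.≤-trans a≤b b≤j))
  ... | no  _   | yes _   | no  _   = refl
  ... | no  _   | no  j≮b | no  b≰j = ⊥-elim (j≮b (ℕP.≰⇒> b≰j))

module _ {n : ℕ} (P : PetrieData n) where

  rowSelect-stepMatrix : ∀ σ r j → rowSelect σ (stepMatrix (a P)) (stepMatrix (b P)) r j ≡ stepMatrix (src P σ) r j
  rowSelect-stepMatrix σ r j = sym (BoolP.if-float (λ v → 𝟙ℤ ⌊ v ℕ.≤? toℕ j ⌋) (σ r))

  signed-permSign : ∀ σ → sgn (size σ) * permSign (src P σ) ≡ (if ⌊ good? P σ ⌋ then w P σ else 0ℤ)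
  signed-permSign σ = by-cases ⌊ good? P σ ⌋
    where
    by-cases : ∀ β → sgn (size σ) * (if β then sgn (inv P σ) else 0ℤ) ≡ (if β then w P σ else 0ℤ)
    by-cases true  = sym (sgn-+ (size σ) (inv P σ))
    by-cases false = ℤP.*-zeroʳ (sgn (size σ))

  det-petrieMatrix : det n (petrieMatrix P) ≡ sumGood P
  det-petrieMatrix = begin
    det n (petrieMatrix P)
      ≡⟨ det-cong n (petrieMatrix-row-difference P) ⟩
    det n (λ r j → stepMatrix (a P) r j - stepMatrix (b P) r j)
      ≡⟨ det-row-difference n (stepMatrix (a P)) (stepMatrix (b P)) ⟩
    ∑ₒ n (λ σ → sgn (size σ) * det n (rowSelect σ (stepMatrix (a P)) (stepMatrix (b P))))
      ≡⟨ listSum-cong (allOrientations n) (λ σ → cong (sgn (size σ) *_)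
           (trans (det-cong n (rowSelect-stepMatrix σ)) (det-stepMatrix n (src P σ)))) ⟩
    ∑ₒ n (λ σ → sgn (size σ) * permSign (src P σ))
      ≡⟨ listSum-cong (allOrientations n) signed-permSign ⟩
    ∑ₒ n (λ σ → if ⌊ good? P σ ⌋ then w P σ else 0ℤ)
      ≡⟨ listSum-filter (good? P) (allOrientations n) (w P) ⟨
    sumGood P ∎
    where open ≡-Reasoning

  src-cong : ∀ {τ σ} → τ ≗ σ → src P τ ≗ src P σ
  src-cong τ≗σ r = cong (λ β → if β then b P r else a P r) (τ≗σ r)

  w-cong : ∀ {τ σ} → τ ≗ σ → w P τ ≡ w P σ
  w-cong {τ} {σ} τ≗σ = cong sgn (cong₂ ℕ._+_
    (trans (size-∑ τ) (trans (ℕ∑.sum-cong-≗ (cong 𝟙 ∘ τ≗σ)) (sym (size-∑ σ))))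
    (inversions-cong (src P τ) (src P σ) (src-cong τ≗σ)))

  good-cong : ∀ {τ σ} → τ ≗ σ → Good P σ → Good P τ
  good-cong τ≗σ (bounded , inj) =
    (λ r → subst (_< n) (sym (src-cong τ≗σ r)) (bounded r)) ,
    (λ r s e → inj r s (trans (sym (src-cong τ≗σ r)) (trans e (src-cong τ≗σ s))))

  det-petrieMatrix-unique : ∀ σ → Good P σ → (∀ τ → Good P τ → τ ≗ σ) → det n (petrieMatrix P) ≡ w P σ
  det-petrieMatrix-unique σ good unique = begin
    det n (petrieMatrix P)    ≡⟨ det-petrieMatrix ⟩
    sumGood P                 ≡⟨ listSum-filter (good? P) (allOrientations n) (w P) ⟩
    ∑ₒ n weight               ≡⟨ ∑ₒ-supported n σ weight off on ⟩
    weight σ                  ≡⟨ cong (λ β → if β then w P σ else 0ℤ) (⌊⌋-true (good? P σ) good) ⟩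
    w P σ                     ∎
    where
    open ≡-Reasoning
    weight : Orientation n → ℤ
    weight τ = if ⌊ good? P τ ⌋ then w P τ else 0ℤ
    off : ∀ τ → ¬ τ ≗ σ → weight τ ≡ 0ℤ
    off τ τ≉σ = cong (λ β → if β then w P τ else 0ℤ) (⌊⌋-false (good? P τ) (τ≉σ ∘ unique τ))
    on : ∀ τ → τ ≗ σ → weight τ ≡ weight σ
    on τ τ≗σ rewrite ⌊⌋-true (good? P τ) (good-cong τ≗σ good) | ⌊⌋-true (good? P σ) good = w-cong τ≗σ

transpose : ℕ → ℕ → ℕ → ℕ
transpose x y z = if ⌊ z ℕ.≟ x ⌋ then y else if ⌊ z ℕ.≟ y ⌋ then x else z

data TransposeView (x y z : ℕ) : Set where
  at-x      : z ≡ x → TransposeView x y z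
  at-y      : z ≡ y → z ≢ x → TransposeView x y z
  elsewhere : z ≢ x → z ≢ y → TransposeView x y z

transposeView : ∀ x y z → TransposeView x y z
transposeView x y z with z ℕ.≟ x | z ℕ.≟ y
... | yes z≡x | _       = at-x z≡x
... | no  z≢x | yes z≡y = at-y z≡y z≢x
... | no  z≢x | no  z≢y = elsewhere z≢x z≢y

transpose-x : ∀ x y → transpose x y x ≡ y
transpose-x x y rewrite ⌊⌋-true (x ℕ.≟ x) refl = refl

transpose-y : ∀ x y → x ≢ y → transpose x y y ≡ x
transpose-y x y x≢y rewrite ⌊⌋-false (y ℕ.≟ x) (x≢y ∘ sym) | ⌊⌋-true (y ℕ.≟ y) refl = refl

transpose-other : ∀ x y z → z ≢ x → z ≢ y → transpose x y z ≡ z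
transpose-other x y z z≢x z≢y rewrite ⌊⌋-false (z ℕ.≟ x) z≢x | ⌊⌋-false (z ℕ.≟ y) z≢y = refl

transpose-involutive : ∀ x y z → transpose x y (transpose x y z) ≡ z
transpose-involutive x y z with transposeView x y z
... | at-x refl = trans (cong (transpose z y) (transpose-x z y)) (back-to-x (y ℕ.≟ z))
  where
  back-to-x : Dec (y ≡ z) → transpose z y y ≡ z
  back-to-x (yes refl) = transpose-x y y
  back-to-x (no  y≢z)  = transpose-y z y (y≢z ∘ sym)
transpose-involutive x y z | at-y refl z≢x =
  trans (cong (transpose x z) (transpose-y x z (z≢x ∘ sym))) (transpose-x x z)
transpose-involutive x y z | elsewhere z≢x z≢y =
  trans (cong (transpose x y) (transpose-other x y z z≢x z≢y)) (transpose-other x y z z≢x z≢y)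

transpose-injective : ∀ x y u v → transpose x y u ≡ transpose x y v → u ≡ v
transpose-injective x y u v e =
  trans (sym (transpose-involutive x y u)) (trans (cong (transpose x y) e) (transpose-involutive x y v))

transpose-comm : ∀ x y z → transpose x y z ≡ transpose y x z
transpose-comm x y z with transposeView x y z
... | at-x refl with y ℕ.≟ z
...   | yes refl = refl
...   | no  y≢z  = trans (transpose-x z y) (sym (transpose-y y z y≢z))
transpose-comm x y z | at-y refl z≢x = trans (transpose-y x z (z≢x ∘ sym)) (sym (transpose-x z x))
transpose-comm x y z | elsewhere z≢x z≢y = trans (transpose-other x y z z≢x z≢y) (sym (transpose-other y x z z≢y z≢x))

transpose-conjugate : ∀ x y z → suc x < y →
                      transpose x y z ≡ transpose x (suc x) (transpose (suc x) y (transpose x (suc x) z))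
transpose-conjugate x y z x+1<y with transposeView x y z
... | at-x refl rewrite transpose-x z (suc z) | transpose-x (suc z) y | transpose-x z y
                      | transpose-other z (suc z) y (ℕP.<⇒≢ (ℕP.<-trans (ℕP.n<1+n z) x+1<y) ∘ sym) (ℕP.<⇒≢ x+1<y ∘ sym) = refl
... | at-y refl z≢x rewrite transpose-y x z (z≢x ∘ sym)
                          | transpose-other x (suc x) z z≢x (ℕP.<⇒≢ x+1<y ∘ sym)
                          | transpose-y (suc x) z (ℕP.<⇒≢ x+1<y)
                          | transpose-y x (suc x) (ℕP.<⇒≢ (ℕP.n<1+n x)) = refl
... | elsewhere z≢x z≢y = by-cases (z ℕ.≟ suc x)
  where
  open ≡-Reasoning
  x≢x+1 : x ≢ suc x
  x≢x+1 = ℕP.<⇒≢ (ℕP.n<1+n x)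
  by-cases : Dec (z ≡ suc x) → transpose x y z ≡ transpose x (suc x) (transpose (suc x) y (transpose x (suc x) z))
  by-cases (yes refl) = begin
    transpose x y (suc x)
      ≡⟨ transpose-other x y (suc x) z≢x z≢y ⟩
    suc x
      ≡⟨ transpose-x x (suc x) ⟨
    transpose x (suc x) x
      ≡⟨ cong (transpose x (suc x)) (transpose-other (suc x) y x x≢x+1 (ℕP.<⇒≢ (ℕP.<-trans (ℕP.n<1+n x) x+1<y))) ⟨
    transpose x (suc x) (transpose (suc x) y x)
      ≡⟨ cong (λ v → transpose x (suc x) (transpose (suc x) y v)) (transpose-y x (suc x) x≢x+1) ⟨
    transpose x (suc x) (transpose (suc x) y (transpose x (suc x) (suc x))) ∎
  by-cases (no z≢x+1) = begin
    transpose x y z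
      ≡⟨ transpose-other x y z z≢x z≢y ⟩
    z
      ≡⟨ transpose-other x (suc x) z z≢x z≢x+1 ⟨
    transpose x (suc x) z
      ≡⟨ cong (transpose x (suc x)) (transpose-other (suc x) y z z≢x+1 z≢y) ⟨
    transpose x (suc x) (transpose (suc x) y z)
      ≡⟨ cong (λ v → transpose x (suc x) (transpose (suc x) y v)) (transpose-other x (suc x) z z≢x z≢x+1) ⟨
    transpose x (suc x) (transpose (suc x) y (transpose x (suc x) z)) ∎

adjacent-preserves-< : ∀ x u v → ¬ (u ≡ suc x × v ≡ x) → v < u → transpose x (suc x) v < transpose x (suc x) u
adjacent-preserves-< x u v not-pair v<u with transposeView x (suc x) u
... | at-x refl rewrite transpose-x u (suc u)
                      | transpose-other u (suc u) v (ℕP.<⇒≢ v<u) (ℕP.<⇒≢ (ℕP.m<n⇒m<1+n v<u)) = ℕP.m<n⇒m<1+n v<u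
... | at-y refl _ rewrite transpose-y x (suc x) (ℕP.<⇒≢ (ℕP.n<1+n x))
                        | transpose-other x (suc x) v (λ v≡x → not-pair (refl , v≡x)) (ℕP.<⇒≢ v<u) =
  ℕP.≤∧≢⇒< (ℕP.≤-pred v<u) (λ v≡x → not-pair (refl , v≡x))
... | elsewhere u≢x u≢x+1 rewrite transpose-other x (suc x) u u≢x u≢x+1 with transposeView x (suc x) v
...   | at-x refl rewrite transpose-x v (suc v) = ℕP.≤∧≢⇒< v<u (u≢x+1 ∘ sym)
...   | at-y refl _ rewrite transpose-y x (suc x) (ℕP.<⇒≢ (ℕP.n<1+n x)) = ℕP.<-trans (ℕP.n<1+n x) v<u
...   | elsewhere v≢x v≢x+1 rewrite transpose-other x (suc x) v v≢x v≢x+1 = v<u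

adjacent-reflects-< : ∀ x u v → ¬ (u ≡ x × v ≡ suc x) → transpose x (suc x) v < transpose x (suc x) u → v < u
adjacent-reflects-< x u v not-pair lt = subst₂ _<_ (transpose-involutive x (suc x) v) (transpose-involutive x (suc x) u)
  (adjacent-preserves-< x (transpose x (suc x) u) (transpose x (suc x) v) not-swapped-pair lt)
  where
  s = transpose x (suc x)
  back : ∀ z w → s z ≡ w → z ≡ s w
  back z w e = trans (sym (transpose-involutive x (suc x) z)) (cong s e)
  not-swapped-pair : ¬ (s u ≡ suc x × s v ≡ x)
  not-swapped-pair (su≡x+1 , sv≡x) = not-pair
    ( trans (back u (suc x) su≡x+1) (transpose-y x (suc x) (ℕP.<⇒≢ (ℕP.n<1+n x)))
    , trans (back v x sv≡x) (transpose-x x (suc x)))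

inversions-adjacent-absent : ∀ {n} (c : Fin n → ℕ) x → (∀ r s → c r ≡ x → c s ≡ suc x → ⊥) →
                             inversions (transpose x (suc x) ∘ c) ≡ inversions c
inversions-adjacent-absent c x not-both = inversions-cong-< (transpose x (suc x) ∘ c) c
  (λ r s → adjacent-reflects-< x (c r) (c s) (λ (p , q) → not-both r s p q))
  (λ r s → adjacent-preserves-< x (c r) (c s) (λ (p , q) → not-both s r q p))

inverted-< : ∀ {n} (c : Fin n → ℕ) r s → c s < c r → inverted c r s ≡ 𝟙 ⌊ r FinP.<? s ⌋
inverted-< c r s lt rewrite ⌊⌋-true (c s ℕ.<? c r) lt = cong 𝟙 (BoolP.∧-identityʳ _)

inverted-≮ : ∀ {n} (c : Fin n → ℕ) r s → ¬ c s < c r → inverted c r s ≡ 0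
inverted-≮ c r s ≮ rewrite ⌊⌋-false (c s ℕ.<? c r) ≮ = cong 𝟙 (BoolP.∧-zeroʳ _)

-- Of all pairs of positions, only {p, q} changes its inversion status.
inversions-adjacent : ∀ {n} (c : Fin n → ℕ) x p q → Injective c → c p ≡ x → c q ≡ suc x →
                      inversions (transpose x (suc x) ∘ c) ℕ.+ 𝟙 ⌊ q FinP.<? p ⌋ ≡ inversions c ℕ.+ 𝟙 ⌊ p FinP.<? q ⌋
inversions-adjacent c x p q inj cp≡x cq≡1+x = begin
  inversions c′ ℕ.+ 𝟙 ⌊ q FinP.<? p ⌋
    ≡⟨ cong₂ ℕ._+_ (inversions-∑ c′) (sym before) ⟩
  ∑∑ (inverted c′) ℕ.+ (inverted c p q ℕ.+ inverted c q p)
    ≡⟨ ∑∑-exchange (inverted c′) (inverted c) p q p≢q agree ⟩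
  ∑∑ (inverted c) ℕ.+ (inverted c′ p q ℕ.+ inverted c′ q p)
    ≡⟨ cong₂ ℕ._+_ (inversions-∑ c) (sym after) ⟨
  inversions c ℕ.+ 𝟙 ⌊ p FinP.<? q ⌋ ∎
  where
  open ≡-Reasoning
  c′ = transpose x (suc x) ∘ c
  x<1+x : x < suc x
  x<1+x = ℕP.n<1+n x
  p≢q : p ≢ q
  p≢q p≡q = ℕP.1+n≢n (trans (sym cq≡1+x) (trans (cong c (sym p≡q)) cp≡x))
  cp<cq : c p < c q
  cp<cq = subst₂ _<_ (sym cp≡x) (sym cq≡1+x) x<1+x
  c′q<c′p : c′ q < c′ p
  c′q<c′p = subst₂ _<_ (sym (trans (cong (transpose x (suc x)) cq≡1+x) (transpose-y x (suc x) (ℕP.<⇒≢ x<1+x))))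
                       (sym (trans (cong (transpose x (suc x)) cp≡x) (transpose-x x (suc x)))) x<1+x
  before : inverted c p q ℕ.+ inverted c q p ≡ 𝟙 ⌊ q FinP.<? p ⌋
  before = cong₂ ℕ._+_ (inverted-≮ c p q (ℕP.<-asym cp<cq)) (inverted-< c q p cp<cq)
  after : inverted c′ p q ℕ.+ inverted c′ q p ≡ 𝟙 ⌊ p FinP.<? q ⌋
  after = trans (cong₂ ℕ._+_ (inverted-< c′ p q c′q<c′p) (inverted-≮ c′ q p (ℕP.<-asym c′q<c′p))) (ℕP.+-identityʳ _)
  agree : ∀ r s → ¬ (r ≡ p × s ≡ q) → ¬ (r ≡ q × s ≡ p) → inverted c′ r s ≡ inverted c r s
  agree r s ¬pq ¬qp = cong (λ β → 𝟙 (⌊ r FinP.<? s ⌋ ∧ β))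
    (⌊⌋-⇔ (adjacent-reflects-< x (c r) (c s) not-pq) (adjacent-preserves-< x (c r) (c s) not-qp) (c′ s ℕ.<? c′ r) (c s ℕ.<? c r))
    where
    not-pq : ¬ (c r ≡ x × c s ≡ suc x)
    not-pq (cr≡x , cs≡1+x) = ¬pq (inj r p (trans cr≡x (sym cp≡x)) , inj s q (trans cs≡1+x (sym cq≡1+x)))
    not-qp : ¬ (c r ≡ suc x × c s ≡ x)
    not-qp (cr≡1+x , cs≡x) = ¬qp (inj r q (trans cr≡1+x (sym cq≡1+x)) , inj s p (trans cs≡x (sym cp≡x)))

sgn-inversions-adjacent : ∀ {n} (c : Fin n → ℕ) x p q → Injective c → c p ≡ x → c q ≡ suc x →
                          sgn (inversions (transpose x (suc x) ∘ c)) ≡ - sgn (inversions c)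
sgn-inversions-adjacent c x p q inj cp≡x cq≡1+x = by-order (FinP.<-cmp p q)
  where
  c′ = transpose x (suc x) ∘ c
  exchanged : inversions c′ ℕ.+ 𝟙 ⌊ q FinP.<? p ⌋ ≡ inversions c ℕ.+ 𝟙 ⌊ p FinP.<? q ⌋
  exchanged = inversions-adjacent c x p q inj cp≡x cq≡1+x
  by-order : Tri (p Fin.< q) (p ≡ q) (q Fin.< p) → sgn (inversions c′) ≡ - sgn (inversions c)
  by-order (tri< p<q _ _) = trans (cong sgn one-more) (sgn-suc (inversions c))
    where
    one-more : inversions c′ ≡ suc (inversions c)
    one-more = trans (sym (ℕP.+-identityʳ _)) (trans (subst₂ (λ β γ → inversions c′ ℕ.+ 𝟙 β ≡ inversions c ℕ.+ 𝟙 γ)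
                 (⌊⌋-false (q FinP.<? p) (FinP.<-asym p<q)) (⌊⌋-true (p FinP.<? q) p<q) exchanged)
                 (ℕP.+-comm (inversions c) 1))
  by-order (tri≈ _ p≡q _) = ⊥-elim (ℕP.1+n≢n (trans (sym cq≡1+x) (trans (cong c (sym p≡q)) cp≡x)))
  by-order (tri> _ _ q<p) = trans (sym (ℤP.neg-involutive _)) (cong -_ (trans (sym (sgn-suc (inversions c′))) (cong sgn (sym one-more))))
    where
    one-more : inversions c ≡ suc (inversions c′)
    one-more = trans (sym (ℕP.+-identityʳ _)) (trans (sym (subst₂ (λ β γ → inversions c′ ℕ.+ 𝟙 β ≡ inversions c ℕ.+ 𝟙 γ)
                 (⌊⌋-true (q FinP.<? p) q<p) (⌊⌋-false (p FinP.<? q) (FinP.<-asym q<p)) exchanged))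
                 (ℕP.+-comm (inversions c′) 1))

transpose-∘-injective : ∀ {n} x y (c : Fin n → ℕ) → Injective c → Injective (transpose x y ∘ c)
transpose-∘-injective x y c inj r s e = inj r s (transpose-injective x y (c r) (c s) e)

-- Induction on the gap d = y - x - 1, conjugating by (x x+1).
sgn-inversions-transpose-< : ∀ d {n} (c : Fin n → ℕ) x y → y ≡ suc (x ℕ.+ d) → Injective c →
  (∃ λ p → c p ≡ x) → (∃ λ q → c q ≡ y) → sgn (inversions (transpose x y ∘ c)) ≡ - sgn (inversions c)
sgn-inversions-transpose-< zero c x y y≡1+x+0 inj (p , cp≡x) (q , cq≡y) =
  subst (λ y → sgn (inversions (transpose x y ∘ c)) ≡ - sgn (inversions c)) (sym y≡1+x)
        (sgn-inversions-adjacent c x p q inj cp≡x (trans cq≡y y≡1+x))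
  where
  y≡1+x : y ≡ suc x
  y≡1+x = trans y≡1+x+0 (cong suc (ℕP.+-identityʳ x))
sgn-inversions-transpose-< (suc d) {n} c x y y≡1+x+d inj (p , cp≡x) (q , cq≡y) = begin
  sgn (inversions (transpose x y ∘ c))  ≡⟨ cong sgn (inversions-cong _ c₃ (λ r → transpose-conjugate x y (c r) x+1<y)) ⟩
  sgn (inversions c₃)                   ≡⟨ by-cases (FinP.any? (λ r → c r ℕ.≟ suc x)) ⟩
  - sgn (inversions c)                  ∎
  where
  open ≡-Reasoning
  x+1<y : suc x < y
  x+1<y = subst (suc x <_) (sym y≡1+x+d) (s≤s (subst (suc x ≤_) (sym (ℕP.+-suc x d)) (s≤s (ℕP.m≤m+n x d))))
  x<y : x < y
  x<y = ℕP.<-trans (ℕP.n<1+n x) x+1<y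
  s = transpose x (suc x)
  c₁ c₂ c₃ : Fin n → ℕ
  c₁ = s ∘ c
  c₂ = transpose (suc x) y ∘ c₁
  c₃ = s ∘ c₂
  c₁p≡1+x : c₁ p ≡ suc x
  c₁p≡1+x = trans (cong s cp≡x) (transpose-x x (suc x))
  c₁q≡y : c₁ q ≡ y
  c₁q≡y = trans (cong s cq≡y) (transpose-other x (suc x) y (ℕP.<⇒≢ x<y ∘ sym) (ℕP.<⇒≢ x+1<y ∘ sym))
  IH : sgn (inversions c₂) ≡ - sgn (inversions c₁)
  IH = sgn-inversions-transpose-< d c₁ (suc x) y (trans y≡1+x+d (cong suc (ℕP.+-suc x d))) (transpose-∘-injective x (suc x) c inj)
         (p , c₁p≡1+x) (q , c₁q≡y)
  by-cases : Dec (∃ λ r → c r ≡ suc x) → sgn (inversions c₃) ≡ - sgn (inversions c)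
  by-cases (yes (r , cr≡1+x)) = begin
    sgn (inversions c₃)      ≡⟨ sgn-inversions-adjacent c₂ x r q c₂-inj c₂r≡x c₂q≡1+x ⟩
    - sgn (inversions c₂)    ≡⟨ cong -_ IH ⟩
    - - sgn (inversions c₁)  ≡⟨ ℤP.neg-involutive _ ⟩
    sgn (inversions c₁)      ≡⟨ sgn-inversions-adjacent c x p r inj cp≡x cr≡1+x ⟩
    - sgn (inversions c)     ∎
    where
    c₂-inj : Injective c₂
    c₂-inj = transpose-∘-injective (suc x) y c₁ (transpose-∘-injective x (suc x) c inj)
    c₂r≡x : c₂ r ≡ x
    c₂r≡x = trans (cong (transpose (suc x) y ∘ s) cr≡1+x)
              (trans (cong (transpose (suc x) y) (transpose-y x (suc x) (ℕP.<⇒≢ (ℕP.n<1+n x))))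
                     (transpose-other (suc x) y x (ℕP.<⇒≢ (ℕP.n<1+n x)) (ℕP.<⇒≢ x<y)))
    c₂q≡1+x : c₂ q ≡ suc x
    c₂q≡1+x = trans (cong (transpose (suc x) y) c₁q≡y) (transpose-y (suc x) y (ℕP.<⇒≢ x+1<y))
  by-cases (no ¬hit) = begin
    sgn (inversions c₃)
      ≡⟨ cong sgn (inversions-adjacent-absent c₂ x (λ r _ c₂r≡x _ → ¬hit (r , c-hits-1+x r c₂r≡x))) ⟩
    sgn (inversions c₂)
      ≡⟨ IH ⟩
    - sgn (inversions c₁)
      ≡⟨ cong (-_ ∘ sgn) (inversions-adjacent-absent c x (λ _ s _ cs≡1+x → ¬hit (s , cs≡1+x))) ⟩
    - sgn (inversions c) ∎
    where
    c-hits-1+x : ∀ r → c₂ r ≡ x → c r ≡ suc x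
    c-hits-1+x r c₂r≡x = trans (sym (transpose-involutive x (suc x) (c r))) (trans (cong s c₁r≡x) (transpose-x x (suc x)))
      where
      c₁r≡x : c₁ r ≡ x
      c₁r≡x = trans (sym (transpose-involutive (suc x) y (c₁ r)))
                (trans (cong (transpose (suc x) y) c₂r≡x) (transpose-other (suc x) y x (ℕP.<⇒≢ (ℕP.n<1+n x)) (ℕP.<⇒≢ x<y)))

sgn-inversions-transpose : ∀ {n} (c : Fin n → ℕ) x y → x ≢ y → Injective c →
  (∃ λ p → c p ≡ x) → (∃ λ q → c q ≡ y) → sgn (inversions (transpose x y ∘ c)) ≡ - sgn (inversions c)
sgn-inversions-transpose c x y x≢y inj hit-x hit-y with ℕP.<-cmp x y
... | tri< x<y _ _ = sgn-inversions-transpose-< (y ℕ.∸ suc x) c x y (sym (ℕP.m+[n∸m]≡n x<y)) inj hit-x hit-y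
... | tri≈ _ x≡y _ = ⊥-elim (x≢y x≡y)
... | tri> _ _ y<x = trans (cong sgn (inversions-cong _ _ (λ r → transpose-comm x y (c r))))
                           (sgn-inversions-transpose-< (x ℕ.∸ suc y) c y x (sym (ℕP.m+[n∸m]≡n y<x)) inj hit-y hit-x)

-- cycle v sends v i to v (next i) and fixes every value outside the image of v.
cycle : ∀ {k} → (Fin k → ℕ) → ℕ → ℕ
cycle {zero}        v z = z
cycle {suc zero}    v z = z
cycle {suc (suc k)} v z = transpose (v zero) (v (suc zero)) (cycle (v ∘ suc) z)

cycle-fixes : ∀ {k} (v : Fin k → ℕ) z → (∀ i → v i ≢ z) → cycle v z ≡ z
cycle-fixes {zero}        v z _ = refl
cycle-fixes {suc zero}    v z _ = refl
cycle-fixes {suc (suc k)} v z miss =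
  trans (cong (transpose (v zero) (v (suc zero))) (cycle-fixes (v ∘ suc) z (miss ∘ suc)))
        (transpose-other (v zero) (v (suc zero)) z (miss zero ∘ sym) (miss (suc zero) ∘ sym))

cycle-image : ∀ {k} (v : Fin k → ℕ) z → cycle v z ≡ z ⊎ ∃ λ i → cycle v z ≡ v i
cycle-image {zero}        v z = inj₁ refl
cycle-image {suc zero}    v z = inj₁ refl
cycle-image {suc (suc k)} v z with transposeView (v zero) (v (suc zero)) (cycle (v ∘ suc) z) | cycle-image (v ∘ suc) z
... | at-x e        | _ = inj₂ (suc zero , trans (cong (transpose (v zero) (v (suc zero))) e) (transpose-x (v zero) (v (suc zero))))
... | at-y e w≢v₀   | _ = inj₂ (zero , trans (cong (transpose (v zero) (v (suc zero))) e)
                                            (transpose-y (v zero) (v (suc zero)) (λ v₀≡v₁ → w≢v₀ (trans e (sym v₀≡v₁)))))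
... | elsewhere w≢v₀ w≢v₁ | inj₁ e       = inj₁ (trans (transpose-other _ _ _ w≢v₀ w≢v₁) e)
... | elsewhere w≢v₀ w≢v₁ | inj₂ (i , e) = inj₂ (suc i , trans (transpose-other _ _ _ w≢v₀ w≢v₁) e)

cycle-injective : ∀ {k} (v : Fin k → ℕ) u u′ → cycle v u ≡ cycle v u′ → u ≡ u′
cycle-injective {zero}        v u u′ e = e
cycle-injective {suc zero}    v u u′ e = e
cycle-injective {suc (suc k)} v u u′ e = cycle-injective (v ∘ suc) u u′ (transpose-injective _ _ _ _ e)

next-last : ∀ {k} (i : Fin (suc k)) → toℕ i ≡ k → next i ≡ zero
next-last {k} i i≡k = FinP.toℕ-injective (trans (FinP.toℕ-fromℕ< (m%n<n (suc (toℕ i)) (suc k)))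
                                               (trans (cong (λ t → suc t % suc k) i≡k) (n%n≡0 (suc k))))

toℕ-next : ∀ {k} (i : Fin (suc k)) → toℕ i < k → toℕ (next i) ≡ suc (toℕ i)
toℕ-next {k} i i<k = trans (FinP.toℕ-fromℕ< (m%n<n (suc (toℕ i)) (suc k))) (m<n⇒m%n≡m (s≤s i<k))

cycle-next : ∀ {k} (v : Fin k → ℕ) → Injective v → ∀ i → cycle v (v i) ≡ v (next i)
cycle-next {suc zero}    v inj zero = refl
cycle-next {suc (suc k)} v inj zero = begin
  transpose v₀ v₁ (cycle (v ∘ suc) v₀)
    ≡⟨ cong (transpose v₀ v₁) (cycle-fixes (v ∘ suc) v₀ (λ i e → FinP.0≢1+n (inj zero (suc i) (sym e)))) ⟩
  transpose v₀ v₁ v₀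
    ≡⟨ transpose-x v₀ v₁ ⟩
  v₁
    ≡⟨ cong v (FinP.toℕ-injective (toℕ-next {suc k} zero (s≤s z≤n))) ⟨
  v (next zero)                         ∎
  where
  open ≡-Reasoning
  v₀ = v zero
  v₁ = v (suc zero)
cycle-next {suc (suc k)} v inj (suc j) with toℕ j ℕ.≟ k
... | yes j≡k = begin
  transpose v₀ v₁ (cycle (v ∘ suc) (v (suc j)))  ≡⟨ cong (transpose v₀ v₁) (cycle-next (v ∘ suc) tail-inj j) ⟩
  transpose v₀ v₁ (v (suc (next j)))             ≡⟨ cong (λ i → transpose v₀ v₁ (v (suc i))) (next-last j j≡k) ⟩
  transpose v₀ v₁ v₁                             ≡⟨ transpose-y v₀ v₁ (λ e → FinP.0≢1+n (inj zero (suc zero) e)) ⟩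
  v₀                                             ≡⟨ cong v (next-last (suc j) (cong suc j≡k)) ⟨
  v (next (suc j))                               ∎
  where
  open ≡-Reasoning
  v₀ = v zero
  v₁ = v (suc zero)
  tail-inj : Injective (v ∘ suc)
  tail-inj r s e = FinP.suc-injective (inj (suc r) (suc s) e)
... | no  j≢k = begin
  transpose v₀ v₁ (cycle (v ∘ suc) (v (suc j)))  ≡⟨ cong (transpose v₀ v₁) (cycle-next (v ∘ suc) tail-inj j) ⟩
  transpose v₀ v₁ (v (suc (next j)))             ≡⟨ transpose-other v₀ v₁ _ (λ e → FinP.0≢1+n (inj zero _ (sym e)))
                                                                            (λ e → next≢0 (FinP.suc-injective (inj _ (suc zero) e))) ⟩
  v (suc (next j))                               ≡⟨ cong v next-suc ⟨
  v (next (suc j))                               ∎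
  where
  open ≡-Reasoning
  v₀ = v zero
  v₁ = v (suc zero)
  tail-inj : Injective (v ∘ suc)
  tail-inj r s e = FinP.suc-injective (inj (suc r) (suc s) e)
  j<k : toℕ j < k
  j<k = ℕP.≤∧≢⇒< (ℕP.≤-pred (FinP.toℕ<n j)) j≢k
  next≢0 : next j ≢ zero
  next≢0 e = ℕP.1+n≢0 (trans (sym (toℕ-next j j<k)) (cong toℕ e))
  next-suc : next (suc j) ≡ suc (next j)
  next-suc = FinP.toℕ-injective (trans (toℕ-next (suc j) (s≤s j<k)) (cong suc (sym (toℕ-next j j<k))))

-- A cycle of length m + 1 is a product of m transpositions.
sgn-inversions-cycle : ∀ m {n} (v : Fin (suc m) → ℕ) (c : Fin n → ℕ) → Injective v → Injective c →
                       (∀ i → ∃ λ r → c r ≡ v i) → sgn (inversions (cycle v ∘ c)) ≡ sgn m * sgn (inversions c)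
sgn-inversions-cycle zero    v c _ _ _ = sym (ℤP.*-identityˡ _)
sgn-inversions-cycle (suc m) v c v-inj c-inj hits = begin
  sgn (inversions (transpose (v zero) (v (suc zero)) ∘ c′))
    ≡⟨ sgn-inversions-transpose c′ (v zero) (v (suc zero)) (λ e → FinP.0≢1+n (v-inj zero (suc zero) e)) c′-inj hit-v₀ hit-v₁ ⟩
  - sgn (inversions c′)                ≡⟨ cong -_ (sgn-inversions-cycle m (v ∘ suc) c tail-inj c-inj (hits ∘ suc)) ⟩
  - (sgn m * sgn (inversions c))       ≡⟨ ℤP.neg-distribˡ-* (sgn m) _ ⟩
  (- sgn m) * sgn (inversions c)       ≡⟨ cong (_* sgn (inversions c)) (sgn-suc m) ⟨
  sgn (suc m) * sgn (inversions c)     ∎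
  where
  open ≡-Reasoning
  c′ = cycle (v ∘ suc) ∘ c
  tail-inj : Injective (v ∘ suc)
  tail-inj r s e = FinP.suc-injective (v-inj (suc r) (suc s) e)
  c′-inj : Injective c′
  c′-inj r s e = c-inj r s (cycle-injective (v ∘ suc) (c r) (c s) e)
  hit-v₀ : ∃ λ r → c′ r ≡ v zero
  hit-v₀ = let (r , cr≡v₀) = hits zero in
    r , trans (cong (cycle (v ∘ suc)) cr≡v₀) (cycle-fixes (v ∘ suc) (v zero) (λ i e → FinP.0≢1+n (v-inj zero (suc i) (sym e))))
  hit-v₁ : ∃ λ r → c′ r ≡ v (suc zero)
  hit-v₁ = let (r , cr≡vₗ) = hits (suc (Fin.fromℕ m)) in
    r , trans (cong (cycle (v ∘ suc)) cr≡vₗ)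
              (trans (cycle-next (v ∘ suc) tail-inj (Fin.fromℕ m)) (cong (v ∘ suc) (next-last (Fin.fromℕ m) (FinP.toℕ-fromℕ m))))

𝟙-any : ∀ {n k} (e : Fin k → Fin n) r → Injective e →
        𝟙 ⌊ FinP.any? (λ i → e i FinP.≟ r) ⌋ ≡ ∑ℕ (λ i → 𝟙 ⌊ e i FinP.≟ r ⌋)
𝟙-any {k = zero}  e r inj = refl
𝟙-any {k = suc k} e r inj with e zero FinP.≟ r
... | yes e₀≡r = cong suc (sym (trans (ℕ∑.sum-cong-≗ (λ i → cong 𝟙 (⌊⌋-false (e (suc i) FinP.≟ r)
                   (λ eᵢ≡r → FinP.0≢1+n (inj zero (suc i) (trans e₀≡r (sym eᵢ≡r))))))) (ℕ∑.sum-replicate-zero k)))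
... | no  e₀≢r = trans (cong 𝟙 (⌊⌋-⇔ shift (λ (i , eᵢ≡r) → suc i , eᵢ≡r) _ (FinP.any? (λ i → e (suc i) FinP.≟ r))))
                       (𝟙-any (e ∘ suc) r (λ i j eq → FinP.suc-injective (inj (suc i) (suc j) eq)))
  where
  shift : ∃ (λ i → e i ≡ r) → ∃ (λ i → e (suc i) ≡ r)
  shift (zero  , e₀≡r) = ⊥-elim (e₀≢r e₀≡r)
  shift (suc i , eᵢ≡r) = i , eᵢ≡r

∑-𝟙-any : ∀ {n k} (e : Fin k → Fin n) → Injective e →
          ∑ℕ (λ r → 𝟙 ⌊ FinP.any? (λ i → e i FinP.≟ r) ⌋) ≡ k
∑-𝟙-any {n} {k} e inj = begin
  ∑ℕ (λ r → 𝟙 ⌊ FinP.any? (λ i → e i FinP.≟ r) ⌋)   ≡⟨ ℕ∑.sum-cong-≗ (λ r → 𝟙-any e r inj) ⟩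
  ∑ℕ (λ r → ∑ℕ (λ i → 𝟙 ⌊ e i FinP.≟ r ⌋))          ≡⟨ ℕ∑.∑-comm (λ r i → 𝟙 ⌊ e i FinP.≟ r ⌋) ⟩
  ∑ℕ (λ i → ∑ℕ (λ r → 𝟙 ⌊ e i FinP.≟ r ⌋))          ≡⟨ ℕ∑.sum-cong-≗ (λ i → ∑-at (e i) 1) ⟩
  ∑ℕ (λ (_ : Fin k) → 1)                             ≡⟨ ∑ℕ-ones k ⟩
  k                                                  ∎
  where open ≡-Reasoning

-- A reversed row that gets flipped back contributes 2 to the count, which does not change the sign.
sgn-size-flipRows : ∀ {n k} (σ : Orientation n) (e : Fin k → Fin n) → Injective e →
                    sgn (size (flipRows σ e)) ≡ sgn k * sgn (size σ)
sgn-size-flipRows {n} {k} σ e inj = begin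
  sgn (size (flipRows σ e))                           ≡⟨ cong sgn (size-∑ (flipRows σ e)) ⟩
  sgn (∑ℕ (𝟙 ∘ flipRows σ e))                         ≡⟨ sgn-+-even (∑ℕ (𝟙 ∘ flipRows σ e)) (∑ℕ both) ⟨
  sgn (∑ℕ (𝟙 ∘ flipRows σ e) ℕ.+ (∑ℕ both ℕ.+ ∑ℕ both)) ≡⟨ cong sgn counted ⟩
  sgn (k ℕ.+ size σ)                                  ≡⟨ sgn-+ k (size σ) ⟩
  sgn k * sgn (size σ)                                ∎
  where
  open ≡-Reasoning
  hit : Fin n → Bool
  hit r = ⌊ FinP.any? (λ i → e i FinP.≟ r) ⌋
  both : Fin n → ℕ
  both r = 𝟙 (hit r ∧ σ r)
  pointwise : ∀ β γ → 𝟙 (if β then not γ else γ) ℕ.+ (𝟙 (β ∧ γ) ℕ.+ 𝟙 (β ∧ γ)) ≡ 𝟙 β ℕ.+ 𝟙 γ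
  pointwise true  true  = refl
  pointwise true  false = refl
  pointwise false true  = refl
  pointwise false false = refl
  counted : ∑ℕ (𝟙 ∘ flipRows σ e) ℕ.+ (∑ℕ both ℕ.+ ∑ℕ both) ≡ k ℕ.+ size σ
  counted = begin
    ∑ℕ (𝟙 ∘ flipRows σ e) ℕ.+ (∑ℕ both ℕ.+ ∑ℕ both)
      ≡⟨ cong (∑ℕ (𝟙 ∘ flipRows σ e) ℕ.+_) (ℕ∑.∑-distrib-+ both both) ⟨
    ∑ℕ (𝟙 ∘ flipRows σ e) ℕ.+ ∑ℕ (λ r → both r ℕ.+ both r)
      ≡⟨ ℕ∑.∑-distrib-+ (𝟙 ∘ flipRows σ e) (λ r → both r ℕ.+ both r) ⟨
    ∑ℕ (λ r → 𝟙 (flipRows σ e r) ℕ.+ (both r ℕ.+ both r))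
      ≡⟨ ℕ∑.sum-cong-≗ (λ r → pointwise (hit r) (σ r)) ⟩
    ∑ℕ (λ r → 𝟙 (hit r) ℕ.+ 𝟙 (σ r))
      ≡⟨ ℕ∑.∑-distrib-+ (𝟙 ∘ hit) (𝟙 ∘ σ) ⟩
    ∑ℕ (𝟙 ∘ hit) ℕ.+ ∑ℕ (𝟙 ∘ σ)
      ≡⟨ cong₂ ℕ._+_ (∑-𝟙-any e inj) (sym (size-∑ σ)) ⟩
    k ℕ.+ size σ ∎

module _ {n : ℕ} (P : PetrieData n) (σ : Orientation n) (good : Good P σ) (C : DirectedCycle P σ) where
  private
    c = src P σ
    v = vertex C

  -- Reversing the rows of C moves the outgoing edge of each vertex of C one step along C.
  src-φ : ∀ r → src P (φ C) r ≡ cycle v (c r)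
  src-φ r = by-cases (FinP.any? (λ i → edge C i FinP.≟ r))
    where
    by-cases : (d : Dec (∃ λ i → edge C i ≡ r)) →
               (if (if ⌊ d ⌋ then not (σ r) else σ r) then b P r else a P r) ≡ cycle v (c r)
    by-cases (yes (i , refl)) = begin
      (if not (σ (edge C i)) then b P (edge C i) else a P (edge C i))  ≡⟨ BoolP.if-not (σ (edge C i)) ⟩
      tgt P σ (edge C i)                                                ≡⟨ edge-tgt C i ⟩
      v (next i)                                                        ≡⟨ cycle-next v (vertex-inj C) i ⟨
      cycle v (v i)                                                     ≡⟨ cong (cycle v) (edge-src C i) ⟨
      cycle v (c (edge C i))                                            ∎
      where open ≡-Reasoning
    by-cases (no off-cycle) = sym (cycle-fixes v (c r) λ i vᵢ≡cᵣ →
      off-cycle (i , proj₂ good (edge C i) r (trans (edge-src C i) vᵢ≡cᵣ)))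

  good-φ : Good P (φ C)
  good-φ = bounded , injective
    where
    bounded : ∀ r → src P (φ C) r < n
    bounded r with cycle-image v (c r)
    ... | inj₁ fixed      = subst (_< n) (sym (trans (src-φ r) fixed)) (proj₁ good r)
    ... | inj₂ (i , moved) = subst (_< n) (sym (trans (src-φ r) (trans moved (sym (edge-src C i))))) (proj₁ good (edge C i))
    injective : Injective (src P (φ C))
    injective r s e = proj₂ good r s (cycle-injective v (c r) (c s) (trans (sym (src-φ r)) (trans e (src-φ s))))

  w-φ : w P (φ C) ≡ - w P σ
  w-φ = begin
    w P (φ C)
      ≡⟨ sgn-+ (size (φ C)) (inv P (φ C)) ⟩
    sgn (size (φ C)) * sgn (inversions (src P (φ C)))
      ≡⟨ cong₂ _*_ (sgn-size-flipRows σ (edge C) (edge-inj C)) (cong sgn (inversions-cong _ _ src-φ)) ⟩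
    (sgn (len C) * sgn (size σ)) * sgn (inversions (cycle v ∘ c))
      ≡⟨ reorder (sgn (len C)) (sgn (size σ)) _ ⟩
    sgn (size σ) * (sgn (len C) * sgn (inversions (cycle v ∘ c)))
      ≡⟨ cong (sgn (size σ) *_) (signed-cycle (len C) v (len≥1 C) (vertex-inj C) (λ i → edge C i , edge-src C i)) ⟩
    sgn (size σ) * - sgn (inversions c)
      ≡⟨ ℤP.neg-distribʳ-* (sgn (size σ)) _ ⟨
    - (sgn (size σ) * sgn (inversions c))
      ≡⟨ cong -_ (sgn-+ (size σ) (inv P σ)) ⟨
    - w P σ ∎
    where
    open ≡-Reasoning
    reorder : ∀ x y z → (x * y) * z ≡ y * (x * z)
    reorder = solve-∀
    signed-cycle : ∀ k (u : Fin k → ℕ) → 1 ≤ k → Injective u → (∀ i → ∃ λ r → c r ≡ u i) →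
                   sgn k * sgn (inversions (cycle u ∘ c)) ≡ - sgn (inversions c)
    signed-cycle (suc m) u _ u-inj hits = begin
      sgn (suc m) * sgn (inversions (cycle u ∘ c))  ≡⟨ cong₂ _*_ (sgn-suc m) (sgn-inversions-cycle m u c u-inj (proj₂ good) hits) ⟩
      (- sgn m) * (sgn m * sgn (inversions c))      ≡⟨ neg-square (sgn m) (sgn (inversions c)) ⟩
      - ((sgn m * sgn m) * sgn (inversions c))      ≡⟨ cong (λ x → - (x * sgn (inversions c))) (sgn-sq m) ⟩
      - (1ℤ * sgn (inversions c))                   ≡⟨ cong -_ (ℤP.*-identityˡ _) ⟩
      - sgn (inversions c)                          ∎
      where
      neg-square : ∀ x y → (- x) * (x * y) ≡ - ((x * x) * y)
      neg-square = solve-∀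

theorem4p5 : (n : ℕ) → 1 ≤ n → (P : PetrieData n) →
    ((σ : Orientation n) → Good P σ →
       ((τ : Orientation n) → Good P τ → ∀ r → τ r ≡ σ r) →
       det n (petrieMatrix P) ≡ w P σ)
  × ((Σ (Orientation n) λ σ₁ → Σ (Orientation n) λ σ₂ →
        Good P σ₁ × Good P σ₂ × ∃ λ r → σ₁ r ≢ σ₂ r) →
       (σ : Orientation n) → Good P σ → (C : DirectedCycle P σ) →
       Good P (φ C) × w P (φ C) ≡ - w P σ)
  × det n (petrieMatrix P) ≡ sumGood P
theorem4p5 n _ P =
    det-petrieMatrix-unique P
  , (λ _ σ good C → good-φ P σ good C , w-φ P σ good C)
  , det-petrieMatrix P
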